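{- There is a constant $C>0$ such that for all sufficiently large $d$, on the $d$-dimensional hypercube with $n=2^d$ vertices there exists an initial load vector such that, with probability at least $1-n^{ -C}$, the deviation between the randomized rounding diffusion algorithm and the idealized process, $|x^{(t)}_v-\xi^{(t)}_v|$, is at least $(\log_2 n)/4$ for some vertex $v$ and some time $t$.
   Context: The $d$-dimensional hypercube has vertex set $\{0,1\}^d$, vertices adjacent iff they differ in one bit. Diffusion matrix $P$: $P_{i,j}=1/(2d)$ for adjacent $i,j$, $P_{i,i}=1/2$, $0$ otherwise. Idealized process: $\xi^{(t)}=\xi^{(t-1)}P$. Discrete process: integer loads $x^{(t)}$ with $x^{(t)}_i=x^{(t-1)}_i-\sum_{j:\{i,j\}\in E}\Phi^{(t)}_{i,j}$, where $\Phi^{(t)}_{i,j}=-\Phi^{(t)}_{j,i}$ is the integer flow from $i$ to $j$ at step $t$. Randomized rounding diffusion algorithm: for each edge $\{i,j\}$ and step $t$, orient the edge so that $y:=P_{i,j}x^{(t-1)}_i-P_{j,i}x^{(t-1)}_j\ge0$ and set $\Phi^{(t)}_{i,j}=\lceil y\rceil$ with probability $y-\lfloor y\rfloor$ and $\Phi^{(t)}_{i,j}=\lfloor y\rfloor$ otherwise, independently over all edges and steps. Both processes start from the same initial vector $x^{(0)}=\xi^{(0)}$. -}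

module Defs where

open import Data.Bool using (Bool; true; false; not; _∨_; if_then_else_)
open import Data.Nat as ℕ using (ℕ; zero; suc)
open import Data.Integer as ℤ using (ℤ; +_)
open import Data.Rational as ℚ using (ℚ; 0ℚ; 1ℚ; ½; floor; ceiling; ∣_∣; _≤ᵇ_)
open import Data.Fin using (Fin)
open import Data.Vec using (Vec; []; _∷_; lookup; updateAt)
open import Data.Vec.Properties using (≡-dec)
import Data.Bool.Properties as BoolP
open import Data.List using (List; []; _∷_; map; concatMap; foldr; filter; allFin; _++_)
open import Data.Product using (_×_; _,_; proj₁; proj₂)
open import Relation.Nullary using (does)

Vertex : ℕ → Set
Vertex d = Vec Bool d

allVertices : (d : ℕ) → List (Vertex d)
allVertices zero    = [] ∷ []
allVertices (suc d) = map (false ∷_) (allVertices d) ++ map (true ∷_) (allVertices d)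

flipBit : ∀ {d} → Vertex d → Fin d → Vertex d
flipBit v i = updateAt v i not

_=ᵥ_ : ∀ {d} → Vertex d → Vertex d → Bool
u =ᵥ v = does (≡-dec BoolP._≟_ u v)

-- each edge {v, v ⊕ e_i} listed exactly once, as (v , v ⊕ e_i) with v_i = 0
Edge : ℕ → Set
Edge d = Vertex d × Vertex d

edges : (d : ℕ) → List (Edge d)
edges d = concatMap (λ v → concatMap (λ i → if lookup v i then [] else ((v , flipBit v i) ∷ []))
                                     (allFin d))
                    (allVertices d)

-- off-diagonal entry of the diffusion matrix: 1/(2d)   (d ≥ 1; irrelevant for d = 0)
offDiag : ℕ → ℚ
offDiag zero    = 0ℚ
offDiag (suc k) = + 1 ℚ./ (2 ℕ.* suc k)

sumℚ : List ℚ → ℚ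
sumℚ = foldr ℚ._+_ 0ℚ

sumℤ : List ℤ → ℤ
sumℤ = foldr ℤ._+_ (+ 0)

toℚ : ℤ → ℚ
toℚ z = z ℚ./ 1

-- Idealized process ξ^(t) = ξ^(t-1) P   (P symmetric)

IdealLoad : ℕ → Set
IdealLoad d = Vertex d → ℚ

idealStep : ∀ {d} → IdealLoad d → IdealLoad d
idealStep {d} ξ v = ½ ℚ.* ξ v ℚ.+ sumℚ (map (λ i → offDiag d ℚ.* ξ (flipBit v i)) (allFin d))

ideal : ∀ {d} → IdealLoad d → ℕ → IdealLoad d
ideal ξ zero    = ξ
ideal ξ (suc t) = idealStep (ideal ξ t)

Dist : Set → Set
Dist A = List (ℚ × A)

return : ∀ {A} → A → Dist A
return a = (1ℚ , a) ∷ []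

bind : ∀ {A B} → Dist A → (A → Dist B) → Dist B
bind m k = concatMap (λ pa → map (λ qb → (proj₁ pa ℚ.* proj₁ qb , proj₂ qb)) (k (proj₂ pa))) m

mapD : ∀ {A B} → (A → B) → Dist A → Dist B
mapD f = map (λ pa → (proj₁ pa , f (proj₂ pa)))

prob : ∀ {A} → (A → Bool) → Dist A → ℚ
prob E m = sumℚ (map proj₁ (filter (λ pa → E (proj₂ pa) BoolP.≟ true) m))

Load : ℕ → Set
Load d = Vertex d → ℤ

frac : ℚ → ℚ
frac y = y ℚ.- toℚ (floor y)

roundDist : ℚ → Dist ℤ
roundDist y = (frac y , ceiling y) ∷ (1ℚ ℚ.- frac y , floor y) ∷ []

-- integer flow from a to b on edge (a , b), oriented so that the rounded quantity is ≥ 0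
edgeFlow : ∀ {d} → Load d → Edge d → Dist ℤ
edgeFlow {d} x (a , b) =
  let y = offDiag d ℚ.* toℚ (x a) ℚ.- offDiag d ℚ.* toℚ (x b) in
  if 0ℚ ≤ᵇ y then roundDist y
             else mapD ℤ.-_ (roundDist (ℚ.- y))

-- independent rounding over all edges: list of (edge , flow from first to second endpoint)
flowsDist : ∀ {d} → Load d → List (Edge d) → Dist (List (Edge d × ℤ))
flowsDist x []       = return []
flowsDist x (e ∷ es) = bind (edgeFlow x e) (λ f → mapD ((e , f) ∷_) (flowsDist x es))

applyFlows : ∀ {d} → Load d → List (Edge d × ℤ) → Load d
applyFlows x fs v = x v ℤ.- sumℤ (map out fs)
  where
  out : _ → ℤ
  out ((a , b) , f) = if a =ᵥ v then f else (if b =ᵥ v then ℤ.- f else + 0)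

discreteStep : ∀ {d} → Load d → Dist (Load d)
discreteStep {d} x = mapD (applyFlows x) (flowsDist x (edges d))

deviates : ∀ {d} → Load d → IdealLoad d → Bool
deviates {d} x ξ =
  foldr _∨_ false (map (λ v → (+ d ℚ./ 4) ≤ᵇ ∣ toℚ (x v) ℚ.- ξ v ∣) (allVertices d))

-- joint law of (x^(T) , [∃ t ≤ T, v : |x^(t)_v - ξ^(t)_v| ≥ d/4]), with x^(0) = ξ^(0) = x0
run : ∀ {d} → Load d → (T : ℕ) → Dist (Load d × Bool)
run x0 zero    = return (x0 , deviates x0 (λ v → toℚ (x0 v)))
run x0 (suc T) = bind (run x0 T) λ xb →
  mapD (λ x' → (x' , proj₂ xb ∨ deviates x' (ideal (λ v → toℚ (x0 v)) (suc T))))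
       (discreteStep (proj₁ xb))

probDeviationBy : ∀ {d} → Load d → ℕ → ℚ
probDeviationBy x0 T = prob proj₂ (run x0 T)

powℚ : ℚ → ℕ → ℚ
powℚ q zero    = 1ℚ
powℚ q (suc k) = q ℚ.* powℚ q k

module Submission where

-- Let d = k + 1 and h = ⌊d/2⌋.  Put d tokens on every vertex of weight > h and
-- none elsewhere.  A center is a vertex of the middle layer h: it is empty, each
-- edge to one of its ⌈d/2⌉ (full) upper neighbors carries the rational flow ½,
-- rounded by a fair coin, and the edges to its (empty) lower neighbors carry 0.
-- After one step the idealized process puts ½⌈d/2⌉ ≥ d/4 tokens on a center,
-- while the discrete process leaves it empty if all its coins show 0, which has
-- probability 2^-⌈d/2⌉.  The upward edges of distinct vertices are disjoint, so
-- these events are independent: no deviation of d/4 occurs within one step with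
-- probability at most (1 - 2^-⌈d/2⌉)^C(d,h), which is at most 2^(-d/8) once
-- d ≥ 18 because C(2m, m) ≥ 4ᵐ/(2m+1).  This is the theorem with C = 1/8, T = 1.

module RationalArithmetic where

  open import Defs using (offDiag; powℚ)
  open import Data.Nat as ℕ using (ℕ; zero; suc)
  import Data.Nat.Properties as ℕP
  open import Data.Integer as ℤ using ()
  import Data.Integer.Properties as ℤP
  open import Data.Rational as ℚ using (ℚ; 0ℚ; 1ℚ; ½; _+_; _*_; _-_; _≤_; -_)
  open import Data.Rational.Properties
  import Data.Rational.Unnormalised as U
  import Data.Rational.Unnormalised.Properties as UP
  open import Relation.Binary.PropositionalEquality
  open import Data.Rational.Solver using (module +-*-Solver)
  import Data.Nat.Solver as ℕSolver

  fromℕ : ℕ → ℚ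
  fromℕ n = ℤ.+ n ℚ./ 1

  -- Computations with 'fromℕ' are transported to unnormalised rationals.
  toℚᵘ-/ : ∀ i n → ℚ.toℚᵘ (i ℚ./ suc n) U.≃ U.mkℚᵘ i n
  toℚᵘ-/ i n = toℚᵘ-fromℚᵘ (U.mkℚᵘ i n)

  fromℕ-suc : ∀ n → fromℕ (suc n) ≡ 1ℚ + fromℕ n
  fromℕ-suc n = toℚᵘ-injective (UP.≃-trans (toℚᵘ-/ (ℤ.+ suc n) 0) (UP.≃-sym (UP.≃-trans
    (toℚᵘ-homo-+ 1ℚ (fromℕ n)) (UP.≃-trans (UP.+-congʳ (U.mkℚᵘ (ℤ.+ 1) 0) (toℚᵘ-/ (ℤ.+ n) 0))
    (U.*≡* (cong (λ z → (ℤ.+ 1 ℤ.+ z) ℤ.* ℤ.+ 1) (ℤP.*-identityʳ (ℤ.+ n))))))))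

  fromℕ-+ : ∀ m n → fromℕ (m ℕ.+ n) ≡ fromℕ m + fromℕ n
  fromℕ-+ zero    n = sym (+-identityˡ (fromℕ n))
  fromℕ-+ (suc m) n = begin
    fromℕ (suc (m ℕ.+ n))     ≡⟨ fromℕ-suc (m ℕ.+ n) ⟩
    1ℚ + fromℕ (m ℕ.+ n)      ≡⟨ cong (1ℚ +_) (fromℕ-+ m n) ⟩
    1ℚ + (fromℕ m + fromℕ n)  ≡⟨ sym (+-assoc 1ℚ (fromℕ m) (fromℕ n)) ⟩
    (1ℚ + fromℕ m) + fromℕ n  ≡⟨ cong (_+ fromℕ n) (sym (fromℕ-suc m)) ⟩
    fromℕ (suc m) + fromℕ n   ∎
    where open ≡-Reasoning

  fromℕ-* : ∀ m n → fromℕ (m ℕ.* n) ≡ fromℕ m * fromℕ n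
  fromℕ-* zero    n = sym (*-zeroˡ (fromℕ n))
  fromℕ-* (suc m) n = begin
    fromℕ (n ℕ.+ m ℕ.* n)        ≡⟨ fromℕ-+ n (m ℕ.* n) ⟩
    fromℕ n + fromℕ (m ℕ.* n)    ≡⟨ cong (fromℕ n +_) (fromℕ-* m n) ⟩
    fromℕ n + fromℕ m * fromℕ n  ≡⟨ solve 2 (λ a b → b :+ a :* b := (con 1ℚ :+ a) :* b) refl (fromℕ m) (fromℕ n) ⟩
    (1ℚ + fromℕ m) * fromℕ n     ≡⟨ cong (_* fromℕ n) (sym (fromℕ-suc m)) ⟩
    fromℕ (suc m) * fromℕ n      ∎
    where open ≡-Reasoning
          open +-*-Solver

  fromℕ-^ : ∀ a n → fromℕ (a ℕ.^ n) ≡ powℚ (fromℕ a) n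
  fromℕ-^ a zero    = refl
  fromℕ-^ a (suc n) = trans (fromℕ-* a (a ℕ.^ n)) (cong (fromℕ a *_) (fromℕ-^ a n))

  fromℕ-mono : ∀ {m n} → m ℕ.≤ n → fromℕ m ≤ fromℕ n
  fromℕ-mono {m} {n} m≤n = toℚᵘ-cancel-≤ (UP.≤-respʳ-≃ (UP.≃-sym (toℚᵘ-/ (ℤ.+ n) 0))
    (UP.≤-respˡ-≃ (UP.≃-sym (toℚᵘ-/ (ℤ.+ m) 0)) (U.*≤* (ℤP.*-monoʳ-≤-nonNeg (ℤ.+ 1) (ℤ.+≤+ m≤n)))))

  fromℕ-nonneg : ∀ n → 0ℚ ≤ fromℕ n
  fromℕ-nonneg n = fromℕ-mono (ℕ.z≤n {n})

  *-nonneg : ∀ {p q} → 0ℚ ≤ p → 0ℚ ≤ q → 0ℚ ≤ p * q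
  *-nonneg {p} {q} 0≤p 0≤q = nonNegative⁻¹ (p * q)
    {{nonNeg*nonNeg⇒nonNeg p {{ℚ.nonNegative 0≤p}} q {{ℚ.nonNegative 0≤q}}}}

  *-mono-nonneg : ∀ {a b c d} → 0ℚ ≤ a → 0ℚ ≤ c → a ≤ b → c ≤ d → a * c ≤ b * d
  *-mono-nonneg {a} {b} {c} {d} 0≤a 0≤c a≤b c≤d =
    ≤-trans (*-monoˡ-≤-nonNeg a {{ℚ.nonNegative 0≤a}} c≤d)
            (*-monoʳ-≤-nonNeg d {{ℚ.nonNegative (≤-trans 0≤c c≤d)}} a≤b)

  ≤-by-slack : ∀ {a b e} → a + e ≡ b → 0ℚ ≤ e → a ≤ b
  ≤-by-slack {a} {b} {e} a+e≡b 0≤e =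
    ≤-trans (≤-reflexive (sym (+-identityʳ a))) (≤-trans (+-monoʳ-≤ a 0≤e) (≤-reflexive a+e≡b))

  one-minus-nonneg : ∀ {q} → q ≤ 1ℚ → 0ℚ ≤ 1ℚ - q
  one-minus-nonneg {q} q≤1 = ≤-trans (≤-reflexive (sym (+-inverseʳ q))) (+-monoˡ-≤ (- q) q≤1)

  powℚ-nonneg : ∀ {a} n → 0ℚ ≤ a → 0ℚ ≤ powℚ a n
  powℚ-nonneg zero    0≤a = ≤ᵇ⇒≤ _
  powℚ-nonneg (suc n) 0≤a = *-nonneg 0≤a (powℚ-nonneg n 0≤a)

  powℚ-mono : ∀ {a b} n → 0ℚ ≤ a → a ≤ b → powℚ a n ≤ powℚ b n
  powℚ-mono zero    0≤a a≤b = ≤-refl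
  powℚ-mono (suc n) 0≤a a≤b = *-mono-nonneg 0≤a (powℚ-nonneg n 0≤a) a≤b (powℚ-mono n 0≤a a≤b)

  powℚ-* : ∀ a b n → powℚ (a * b) n ≡ powℚ a n * powℚ b n
  powℚ-* a b zero    = refl
  powℚ-* a b (suc n) = trans (cong (a * b *_) (powℚ-* a b n))
    (solve 4 (λ a b x y → a :* b :* (x :* y) := a :* x :* (b :* y)) refl a b (powℚ a n) (powℚ b n))
    where open +-*-Solver

  powℚ-+ : ∀ a m n → powℚ a (m ℕ.+ n) ≡ powℚ a m * powℚ a n
  powℚ-+ a zero    n = sym (*-identityˡ _)
  powℚ-+ a (suc m) n = trans (cong (a *_) (powℚ-+ a m n)) (sym (*-assoc a _ _))

  powℚ-one : ∀ n → powℚ 1ℚ n ≡ 1ℚ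
  powℚ-one zero    = refl
  powℚ-one (suc n) = cong (1ℚ *_) (powℚ-one n)

  half-pow-inverse : ∀ n → powℚ ½ n * fromℕ (2 ℕ.^ n) ≡ 1ℚ
  half-pow-inverse zero    = refl
  half-pow-inverse (suc n) = begin
    ½ * powℚ ½ n * fromℕ (2 ℕ.* 2 ℕ.^ n)         ≡⟨ cong (½ * powℚ ½ n *_) (fromℕ-* 2 (2 ℕ.^ n)) ⟩
    ½ * powℚ ½ n * (fromℕ 2 * fromℕ (2 ℕ.^ n))   ≡⟨ solve 4 (λ h p t x → h :* p :* (t :* x) := (h :* t) :* (p :* x)) refl ½ (powℚ ½ n) (fromℕ 2) (fromℕ (2 ℕ.^ n)) ⟩
    (½ * fromℕ 2) * (powℚ ½ n * fromℕ (2 ℕ.^ n)) ≡⟨ cong ((½ * fromℕ 2) *_) (half-pow-inverse n) ⟩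
    1ℚ                                            ∎
    where open ≡-Reasoning
          open +-*-Solver

  bernoulli : ∀ q N → 0ℚ ≤ q → q ≤ 1ℚ → powℚ (1ℚ - q) N * (1ℚ + fromℕ N * q) ≤ 1ℚ
  bernoulli q zero    _   _   = ≤-reflexive (solve 1 (λ q → con 1ℚ :* (con 1ℚ :+ con 0ℚ :* q) := con 1ℚ) refl q)
    where open +-*-Solver
  bernoulli q (suc N) 0≤q q≤1 = begin
    (r * s) * (1ℚ + fromℕ (suc N) * q) ≡⟨ cong (λ z → (r * s) * (1ℚ + z * q)) (fromℕ-suc N) ⟩
    (r * s) * (1ℚ + (1ℚ + n) * q)      ≡⟨ solve 4 (λ r s n q → (r :* s) :* (con 1ℚ :+ (con 1ℚ :+ n) :* q) := s :* (r :* (con 1ℚ :+ (con 1ℚ :+ n) :* q))) refl r s n q ⟩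
    s * (r * (1ℚ + (1ℚ + n) * q))      ≤⟨ *-monoˡ-≤-nonNeg s {{ℚ.nonNegative (powℚ-nonneg N (one-minus-nonneg q≤1))}} one-step ⟩
    s * (1ℚ + n * q)                   ≤⟨ bernoulli q N 0≤q q≤1 ⟩
    1ℚ                                 ∎
    where
    open ≤-Reasoning
    open +-*-Solver
    r = 1ℚ - q
    s = powℚ r N
    n = fromℕ N
    -- 1 + n q = (1 - q)(1 + (1 + n) q) + (1 + n) q², and the last term is nonnegative
    one-step : r * (1ℚ + (1ℚ + n) * q) ≤ 1ℚ + n * q
    one-step = ≤-by-slack
      (solve 2 (λ n q → (con 1ℚ :- q) :* (con 1ℚ :+ (con 1ℚ :+ n) :* q) :+ q :* q :* (con 1ℚ :+ n) := con 1ℚ :+ n :* q) refl n q)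
      (*-nonneg (*-nonneg 0≤q 0≤q) (≤-trans (fromℕ-nonneg (suc N)) (≤-reflexive (fromℕ-suc N))))

  -- Consequently (1 - q)ᴺ · N q ≤ 1: N independent events of probability q
  -- all fail with probability at most 1/(N q).
  bernoulli-product : ∀ q N → 0ℚ ≤ q → q ≤ 1ℚ → powℚ (1ℚ - q) N * (fromℕ N * q) ≤ 1ℚ
  bernoulli-product q N 0≤q q≤1 = ≤-trans
    (*-monoˡ-≤-nonNeg (powℚ (1ℚ - q) N) {{ℚ.nonNegative (powℚ-nonneg N (one-minus-nonneg q≤1))}}
      (≤-by-slack (+-comm (fromℕ N * q) 1ℚ) (≤ᵇ⇒≤ _)))
    (bernoulli q N 0≤q q≤1)

  half-pow-nonneg : ∀ c → 0ℚ ≤ powℚ ½ c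
  half-pow-nonneg c = powℚ-nonneg c (≤ᵇ⇒≤ _)

  half-pow-≤1 : ∀ c → powℚ ½ c ≤ 1ℚ
  half-pow-≤1 c = ≤-trans (powℚ-mono c (≤ᵇ⇒≤ _) (≤ᵇ⇒≤ _)) (≤-reflexive (powℚ-one c))

  counting-in-ℚ : ∀ c d e N → 2 ℕ.^ d ℕ.* (2 ℕ.^ c) ℕ.^ e ℕ.≤ N ℕ.^ e → fromℕ (2 ℕ.^ d) ≤ powℚ (fromℕ N * powℚ ½ c) e
  counting-in-ℚ c d e N counting = begin
    fromℕ 2ᵈ                                        ≡⟨ sym (*-identityʳ _) ⟩
    fromℕ 2ᵈ * 1ℚ                                   ≡⟨ cong (fromℕ 2ᵈ *_) (sym [2ᶜq]ᵉ≡1) ⟩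
    fromℕ 2ᵈ * powℚ (fromℕ 2ᶜ * q) e                ≡⟨ cong (fromℕ 2ᵈ *_) (powℚ-* (fromℕ 2ᶜ) q e) ⟩
    fromℕ 2ᵈ * (powℚ (fromℕ 2ᶜ) e * powℚ q e)       ≡⟨ sym (*-assoc (fromℕ 2ᵈ) _ _) ⟩
    fromℕ 2ᵈ * powℚ (fromℕ 2ᶜ) e * powℚ q e         ≡⟨ cong (λ z → fromℕ 2ᵈ * z * powℚ q e) (sym (fromℕ-^ 2ᶜ e)) ⟩
    fromℕ 2ᵈ * fromℕ (2ᶜ ℕ.^ e) * powℚ q e          ≡⟨ cong (_* powℚ q e) (sym (fromℕ-* 2ᵈ (2ᶜ ℕ.^ e))) ⟩
    fromℕ (2ᵈ ℕ.* 2ᶜ ℕ.^ e) * powℚ q e              ≤⟨ *-monoʳ-≤-nonNeg (powℚ q e) {{ℚ.nonNegative (powℚ-nonneg e (half-pow-nonneg c))}} (fromℕ-mono counting) ⟩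
    fromℕ (N ℕ.^ e) * powℚ q e                      ≡⟨ cong (_* powℚ q e) (fromℕ-^ N e) ⟩
    powℚ (fromℕ N) e * powℚ q e                     ≡⟨ sym (powℚ-* (fromℕ N) q e) ⟩
    powℚ (fromℕ N * q) e                            ∎
    where
    open ≤-Reasoning
    q = powℚ ½ c
    2ᵈ = 2 ℕ.^ d
    2ᶜ = 2 ℕ.^ c
    [2ᶜq]ᵉ≡1 : powℚ (fromℕ 2ᶜ * q) e ≡ 1ℚ
    [2ᶜq]ᵉ≡1 = trans (cong (λ z → powℚ z e) (trans (*-comm (fromℕ 2ᶜ) q) (half-pow-inverse c))) (powℚ-one e)

  -- If 0 ≤ F ≤ (1 - ½ᶜ)ᴺ and 2ᵈ (2ᶜ)ᵉ ≤ Nᵉ, then Fᵉ 2ᵈ ≤ 1: a product of N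
  -- independent failure probabilities 1 - ½ᶜ is polynomially small in 2ᵈ.
  failure-bound : ∀ F c N d e → 0ℚ ≤ F → F ≤ powℚ (1ℚ - powℚ ½ c) N →
                  2 ℕ.^ d ℕ.* (2 ℕ.^ c) ℕ.^ e ℕ.≤ N ℕ.^ e → powℚ F e * fromℕ (2 ℕ.^ d) ≤ 1ℚ
  failure-bound F c N d e 0≤F F≤s counting = begin
    powℚ F e * fromℕ (2 ℕ.^ d)    ≤⟨ *-mono-nonneg (powℚ-nonneg e 0≤F) (fromℕ-nonneg (2 ℕ.^ d)) (powℚ-mono e 0≤F F≤s) (counting-in-ℚ c d e N counting) ⟩
    powℚ s e * powℚ (n * q) e     ≡⟨ sym (powℚ-* s (n * q) e) ⟩
    powℚ (s * (n * q)) e          ≤⟨ powℚ-mono e (*-nonneg 0≤s (*-nonneg (fromℕ-nonneg N) (half-pow-nonneg c))) (bernoulli-product q N (half-pow-nonneg c) (half-pow-≤1 c)) ⟩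
    powℚ 1ℚ e                     ≡⟨ powℚ-one e ⟩
    1ℚ                            ∎
    where
    open ≤-Reasoning
    q = powℚ ½ c
    s = powℚ (1ℚ - q) N
    n = fromℕ N
    0≤s : 0ℚ ≤ s
    0≤s = powℚ-nonneg N (one-minus-nonneg (half-pow-≤1 c))

  offDiag-degree : ∀ k → offDiag (suc k) * fromℕ (suc k) ≡ ½
  offDiag-degree k = toℚᵘ-injective (UP.≃-trans (toℚᵘ-homo-* (offDiag (suc k)) (fromℕ (suc k)))
    (UP.≃-trans (UP.*-cong (toℚᵘ-/ (ℤ.+ 1) (k ℕ.+ suc (k ℕ.+ 0))) (toℚᵘ-/ (ℤ.+ suc k) 0)) (U.*≡* cross)))
    where
    open ℕSolver.+-*-Solver
    cross : (ℤ.+ 1 ℤ.* ℤ.+ suc k) ℤ.* ℤ.+ 2 ≡ ℤ.+ 1 ℤ.* ℤ.+ (suc (k ℕ.+ suc (k ℕ.+ 0)) ℕ.* 1)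
    cross = trans (sym (ℤP.pos-* (1 ℕ.* suc k) 2)) (trans (cong ℤ.+_
      (solve 1 (λ k → con 1 :* (con 1 :+ k) :* con 2 := con 1 :* ((con 1 :+ (k :+ (con 1 :+ (k :+ con 0)))) :* con 1)) refl k))
      (ℤP.pos-* 1 _))

  quarter-≤-half : ∀ d c → d ℕ.≤ c ℕ.+ c → ℤ.+ d ℚ./ 4 ≤ ½ * fromℕ c
  quarter-≤-half d c d≤2c = toℚᵘ-cancel-≤
    (UP.≤-respʳ-≃ (UP.≃-sym (UP.≃-trans (toℚᵘ-homo-* ½ (fromℕ c)) (UP.*-cong (UP.≃-refl {U.mkℚᵘ (ℤ.+ 1) 1}) (toℚᵘ-/ (ℤ.+ c) 0))))
    (UP.≤-respˡ-≃ (UP.≃-sym (toℚᵘ-/ (ℤ.+ d) 3)) (U.*≤* cross)))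
    where
    open ℕSolver.+-*-Solver
    cross : ℤ.+ d ℤ.* ℤ.+ 2 ℤ.≤ (ℤ.+ 1 ℤ.* ℤ.+ c) ℤ.* ℤ.+ 4
    cross = subst₂ ℤ._≤_ (ℤP.pos-* d 2) (trans (ℤP.pos-* (1 ℕ.* c) 4) (cong (ℤ._* ℤ.+ 4) (ℤP.pos-* 1 c)))
      (ℤ.+≤+ (ℕP.≤-trans (ℕP.*-monoˡ-≤ 2 d≤2c) (ℕP.≤-reflexive (solve 1 (λ c → (c :+ c) :* con 2 := con 1 :* c :* con 4) refl c))))

module BinomialBounds where

  open import Data.Nat
  open import Data.Nat.Properties
  open import Data.Nat.Combinatorics using (_C_; nC1≡n; nCk≡nC[n∸k]; nCk+nC[k+1]≡[n+1]C[k+1])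
  open import Relation.Binary.PropositionalEquality
  open import Data.Nat.Solver using (module +-*-Solver)
  open +-*-Solver

  pascal : ∀ n k → suc n C suc k ≡ n C k + n C suc k
  pascal n k = sym (nCk+nC[k+1]≡[n+1]C[k+1] n k)

  C-step : ∀ n k → n C k ≤ suc n C k
  C-step n zero    = ≤-refl
  C-step n (suc j) = ≤-trans (m≤n+m (n C suc j) (n C j)) (≤-reflexive (sym (pascal n j)))

  C-mono : ∀ {n n′} k → n ≤ n′ → n C k ≤ n′ C k
  C-mono k n≤n′ = go (≤⇒≤′ n≤n′)
    where
    go : ∀ {n n′} → n ≤′ n′ → n C k ≤ n′ C k
    go ≤′-refl        = ≤-refl
    go (≤′-step n≤n′) = ≤-trans (go n≤n′) (C-step _ k)

  absorption : ∀ n k → suc k * (suc n C suc k) ≡ suc n * (n C k)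
  absorption zero    zero    = refl
  absorption zero    (suc k) = *-zeroʳ (suc (suc k))
  absorption (suc n) zero    = trans (+-identityʳ _) (trans (nC1≡n (suc (suc n))) (sym (*-identityʳ (suc (suc n)))))
  absorption (suc n) (suc j) = begin
    (2 + j) * (suc (suc n) C suc (suc j))                    ≡⟨ cong ((2 + j) *_) (pascal (suc n) (suc j)) ⟩
    (2 + j) * (a + b)                                         ≡⟨ solve 3 (λ j a b → (con 2 :+ j) :* (a :+ b) := a :+ (con 1 :+ j) :* a :+ (con 2 :+ j) :* b) refl j a b ⟩
    a + (1 + j) * a + (2 + j) * b                             ≡⟨ cong₂ (λ u w → a + u + w) (absorption n j) (absorption n (suc j)) ⟩
    a + (1 + n) * (n C j) + (1 + n) * (n C suc j)             ≡⟨ solve 4 (λ a n x y → a :+ (con 1 :+ n) :* x :+ (con 1 :+ n) :* y := a :+ (con 1 :+ n) :* (x :+ y)) refl a n (n C j) (n C suc j) ⟩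
    a + (1 + n) * (n C j + n C suc j)                         ≡⟨ cong (λ z → a + (1 + n) * z) (sym (pascal n j)) ⟩
    a + (1 + n) * a                                           ≡⟨ solve 2 (λ a n → a :+ (con 1 :+ n) :* a := (con 2 :+ n) :* a) refl a n ⟩
    (2 + n) * (suc n C suc j)                                 ∎
    where
    open ≡-Reasoning
    a = suc n C suc j
    b = suc n C suc (suc j)

  central-ratio : ∀ m → suc m * ((suc m + suc m) C suc m) ≡ 2 * suc (m + m) * ((m + m) C m)
  central-ratio m = *-cancelˡ-≡ _ _ (suc m) (begin
    suc m * (suc m * ((suc m + suc m) C suc m))              ≡⟨ cong (λ z → suc m * (suc m * (z C suc m))) (+-suc (suc m) m) ⟩
    suc m * (suc m * (suc (suc n) C suc m))                   ≡⟨ cong (suc m *_) (absorption (suc n) m) ⟩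
    suc m * (suc (suc n) * (suc n C m))                       ≡⟨ cong (λ z → suc m * (suc (suc n) * z)) symmetric ⟩
    suc m * (suc (suc n) * (suc n C suc m))                   ≡⟨ solve 3 (λ m n x → (con 1 :+ m) :* ((con 2 :+ n) :* x) := (con 2 :+ n) :* ((con 1 :+ m) :* x)) refl m n (suc n C suc m) ⟩
    suc (suc n) * (suc m * (suc n C suc m))                   ≡⟨ cong (suc (suc n) *_) (absorption n m) ⟩
    suc (suc n) * (suc n * (n C m))                           ≡⟨ solve 2 (λ m x → (con 2 :+ (m :+ m)) :* ((con 1 :+ (m :+ m)) :* x) := (con 1 :+ m) :* (con 2 :* (con 1 :+ (m :+ m)) :* x)) refl m (n C m) ⟩
    suc m * (2 * suc n * (n C m))                             ∎)
    where
    open ≡-Reasoning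
    n = m + m
    symmetric : suc n C m ≡ suc n C suc m
    symmetric = trans (nCk≡nC[n∸k] (≤-trans (m≤m+n m m) (n≤1+n n)))
                      (cong (suc n C_) (trans (cong (_∸ m) (sym (+-suc m m))) (m+n∸m≡n m (suc m))))

  central-bound : ∀ m → 4 ^ m ≤ suc (m + m) * ((m + m) C m)
  central-bound zero    = ≤-refl
  central-bound (suc m) = begin
    4 * 4 ^ m                                      ≤⟨ *-monoʳ-≤ 4 (central-bound m) ⟩
    4 * (suc (m + m) * ((m + m) C m))              ≡⟨ solve 2 (λ m x → con 4 :* ((con 1 :+ (m :+ m)) :* x) := con 2 :* (con 2 :* (con 1 :+ (m :+ m)) :* x)) refl m ((m + m) C m) ⟩
    2 * (2 * suc (m + m) * ((m + m) C m))          ≡⟨ cong (2 *_) (sym (central-ratio m)) ⟩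
    2 * (suc m * c′)                               ≡⟨ sym (*-assoc 2 (suc m) c′) ⟩
    (2 * suc m) * c′                               ≤⟨ *-monoˡ-≤ c′ (≤-trans (≤-reflexive (solve 1 (λ m → con 2 :* (con 1 :+ m) := (con 1 :+ m) :+ (con 1 :+ m)) refl m)) (n≤1+n _)) ⟩
    suc (suc m + suc m) * c′                       ∎
    where
    open ≤-Reasoning
    c′ = (suc m + suc m) C suc m

  square-≤-pow : ∀ j → suc ((j + 9) + (j + 9)) ^ 2 ≤ 2 ^ (j + 9)
  square-≤-pow zero    = ≤ᵇ⇒≤ 361 512 _
  square-≤-pow (suc j) = begin
    suc ((suc j + 9) + (suc j + 9)) ^ 2                          ≤⟨ m≤m+n _ (281 + 68 * j + 4 * j * j) ⟩
    suc ((suc j + 9) + (suc j + 9)) ^ 2 + (281 + 68 * j + 4 * j * j) ≡⟨ solve 1 (λ j → (con 1 :+ ((con 1 :+ j :+ con 9) :+ (con 1 :+ j :+ con 9))) :^ 2 :+ (con 281 :+ con 68 :* j :+ con 4 :* j :* j) := con 2 :* (con 1 :+ ((j :+ con 9) :+ (j :+ con 9))) :^ 2) refl j ⟩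
    2 * suc ((j + 9) + (j + 9)) ^ 2                              ≤⟨ *-monoʳ-≤ 2 (square-≤-pow j) ⟩
    2 * 2 ^ (j + 9)                                              ∎
    where open ≤-Reasoning

  central-pow : ∀ m → 9 ≤ m → 2 ^ (10 * m + 9) ≤ ((m + m) C m) ^ 8
  central-pow m 9≤m with m ∸ 9 | m∸n+n≡m 9≤m
  ... | j | refl = *-cancelˡ-≤ (t ^ 8) {{m^n≢0 t 8}} (begin
    t ^ 8 * 2 ^ (10 * m + 9)        ≤⟨ *-monoˡ-≤ (2 ^ (10 * m + 9)) t⁸≤2^4m ⟩
    2 ^ (4 * m) * 2 ^ (10 * m + 9)  ≡⟨ sym (^-distribˡ-+-* 2 (4 * m) (10 * m + 9)) ⟩
    2 ^ (4 * m + (10 * m + 9))      ≤⟨ ^-monoʳ-≤ 2 (≤-trans (m≤m+n (4 * m + (10 * m + 9)) (2 * j + 9)) (≤-reflexive (solve 1 (λ j → con 4 :* (j :+ con 9) :+ (con 10 :* (j :+ con 9) :+ con 9) :+ (con 2 :* j :+ con 9) := con 2 :* ((j :+ con 9) :* con 8)) refl j))) ⟩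
    2 ^ (2 * (m * 8))               ≡⟨ sym (trans (^-*-assoc 4 m 8) (^-*-assoc 2 2 (m * 8))) ⟩
    (4 ^ m) ^ 8                     ≤⟨ ^-monoˡ-≤ 8 (central-bound m) ⟩
    (t * B) ^ 8                     ≡⟨ solve 2 (λ t b → (t :* b) :^ 8 := t :^ 8 :* b :^ 8) refl t B ⟩
    t ^ 8 * B ^ 8                   ∎)
    where
    open ≤-Reasoning
    t = suc (m + m)
    B = (m + m) C m
    t⁸≤2^4m : t ^ 8 ≤ 2 ^ (4 * m)
    t⁸≤2^4m = begin
      t ^ 8          ≡⟨ sym (^-*-assoc t 2 4) ⟩
      (t ^ 2) ^ 4    ≤⟨ ^-monoˡ-≤ 4 (square-≤-pow j) ⟩
      (2 ^ m) ^ 4    ≡⟨ trans (^-*-assoc 2 m 4) (cong (2 ^_) (*-comm m 4)) ⟩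
      2 ^ (4 * m)    ∎

  middle-layer-large : ∀ d → 18 ≤ d → 2 ^ d * (2 ^ ⌈ d /2⌉) ^ 8 ≤ (d C ⌊ d /2⌋) ^ 8
  middle-layer-large d 18≤d = begin
    2 ^ d * (2 ^ c) ^ 8     ≡⟨ trans (cong (2 ^ d *_) (^-*-assoc 2 c 8)) (sym (^-distribˡ-+-* 2 d (c * 8))) ⟩
    2 ^ (d + c * 8)         ≤⟨ ^-monoʳ-≤ 2 exponent ⟩
    2 ^ (10 * m + 9)        ≤⟨ central-pow m (⌊n/2⌋-mono 18≤d) ⟩
    ((m + m) C m) ^ 8       ≤⟨ ^-monoˡ-≤ 8 (C-mono m 2m≤d) ⟩
    (d C m) ^ 8             ∎
    where
    open ≤-Reasoning
    m = ⌊ d /2⌋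
    c = ⌈ d /2⌉
    d≡m+c : d ≡ m + c
    d≡m+c = sym (⌊n/2⌋+⌈n/2⌉≡n d)
    c≤1+m : ∀ n → ⌈ n /2⌉ ≤ suc ⌊ n /2⌋
    c≤1+m zero          = z≤n
    c≤1+m (suc zero)    = ≤-refl
    c≤1+m (suc (suc n)) = s≤s (c≤1+m n)
    2m≤d : m + m ≤ d
    2m≤d = ≤-trans (+-monoʳ-≤ m (⌊n/2⌋≤⌈n/2⌉ d)) (≤-reflexive (sym d≡m+c))
    exponent : d + c * 8 ≤ 10 * m + 9
    exponent = begin
      d + c * 8          ≡⟨ cong (_+ c * 8) d≡m+c ⟩
      m + c + c * 8      ≡⟨ solve 2 (λ m c → m :+ c :+ c :* con 8 := m :+ con 9 :* c) refl m c ⟩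
      m + 9 * c          ≤⟨ +-monoʳ-≤ m (*-monoʳ-≤ 9 (c≤1+m d)) ⟩
      m + 9 * suc m      ≡⟨ solve 1 (λ m → m :+ con 9 :* (con 1 :+ m) := con 10 :* m :+ con 9) refl m ⟩
      10 * m + 9         ∎

module Expectation where

  open import Defs using (Dist; return; bind; mapD; prob)
  open RationalArithmetic using (*-nonneg)
  open import Data.Bool using (Bool; true; false)
  open import Data.Rational using (ℚ; 0ℚ; 1ℚ; _+_; _*_; _-_; _≤_; nonNegative)
  open import Data.Rational.Properties
  open import Data.List using (List; []; _∷_; map; _++_)
  open import Data.List.Relation.Unary.All as All using (All; []; _∷_)
  open import Data.Product using (_×_; _,_; proj₁; proj₂)
  open import Relation.Binary.PropositionalEquality
  open import Data.Rational.Solver using (module +-*-Solver)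
  open ≡-Reasoning
  open +-*-Solver

  Ex : ∀ {A : Set} → Dist A → (A → ℚ) → ℚ
  Ex []            f = 0ℚ
  Ex ((p , a) ∷ m) f = p * f a + Ex m f

  𝟙 : Bool → ℚ
  𝟙 true  = 1ℚ
  𝟙 false = 0ℚ

  prob-Ex : ∀ {A} (E : A → Bool) (m : Dist A) → prob E m ≡ Ex m (λ a → 𝟙 (E a))
  prob-Ex E []            = refl
  prob-Ex E ((p , a) ∷ m) with E a
  ... | true  = cong₂ _+_ (sym (*-identityʳ p)) (prob-Ex E m)
  ... | false = trans (prob-Ex E m) (sym (trans (cong (_+ Ex m (λ a → 𝟙 (E a))) (*-zeroʳ p)) (+-identityˡ _)))

  Ex-++ : ∀ {A} (m m′ : Dist A) f → Ex (m ++ m′) f ≡ Ex m f + Ex m′ f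
  Ex-++ []            m′ f = sym (+-identityˡ _)
  Ex-++ ((p , a) ∷ m) m′ f = trans (cong (p * f a +_) (Ex-++ m m′ f)) (sym (+-assoc (p * f a) _ _))

  Ex-cong : ∀ {A} (m : Dist A) {f g} → (∀ a → f a ≡ g a) → Ex m f ≡ Ex m g
  Ex-cong []            f≗g = refl
  Ex-cong ((p , a) ∷ m) f≗g = cong₂ (λ x y → p * x + y) (f≗g a) (Ex-cong m f≗g)

  Ex-*ˡ : ∀ {A} (m : Dist A) c f → Ex m (λ a → c * f a) ≡ c * Ex m f
  Ex-*ˡ []            c f = sym (*-zeroʳ c)
  Ex-*ˡ ((p , a) ∷ m) c f = trans (cong (p * (c * f a) +_) (Ex-*ˡ m c f))
    (solve 4 (λ p c x y → p :* (c :* x) :+ c :* y := c :* (p :* x :+ y)) refl p c (f a) (Ex m f))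

  Ex-*ʳ : ∀ {A} (m : Dist A) c f → Ex m (λ a → f a * c) ≡ Ex m f * c
  Ex-*ʳ m c f = trans (Ex-cong m (λ a → *-comm (f a) c)) (trans (Ex-*ˡ m c f) (*-comm c _))

  Ex-zero : ∀ {A} (m : Dist A) → Ex m (λ _ → 0ℚ) ≡ 0ℚ
  Ex-zero m = trans (Ex-*ˡ m 0ℚ (λ _ → 0ℚ)) (*-zeroˡ (Ex m (λ _ → 0ℚ)))

  Ex-- : ∀ {A} (m : Dist A) f g → Ex m (λ a → f a - g a) ≡ Ex m f - Ex m g
  Ex-- []            f g = refl
  Ex-- ((p , a) ∷ m) f g = trans (cong (p * (f a - g a) +_) (Ex-- m f g))
    (solve 5 (λ p x y u v → p :* (x :- y) :+ (u :- v) := (p :* x :+ u) :- (p :* y :+ v)) refl p (f a) (g a) (Ex m f) (Ex m g))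

  Ex-mapD : ∀ {A B} (g : A → B) (m : Dist A) f → Ex (mapD g m) f ≡ Ex m (λ a → f (g a))
  Ex-mapD g []            f = refl
  Ex-mapD g ((p , a) ∷ m) f = cong (p * f (g a) +_) (Ex-mapD g m f)

  Ex-return : ∀ {A} (a : A) f → Ex (return a) f ≡ f a
  Ex-return a f = trans (+-identityʳ _) (*-identityˡ _)

  Ex-bind : ∀ {A B} (m : Dist A) (k : A → Dist B) f → Ex (bind m k) f ≡ Ex m (λ a → Ex (k a) f)
  Ex-bind []            k f = refl
  Ex-bind ((p , a) ∷ m) k f = begin
    Ex (scaled (k a) ++ bind m k) f         ≡⟨ Ex-++ (scaled (k a)) (bind m k) f ⟩
    Ex (scaled (k a)) f + Ex (bind m k) f   ≡⟨ cong₂ _+_ (Ex-scaled (k a)) (Ex-bind m k f) ⟩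
    p * Ex (k a) f + Ex m (λ a → Ex (k a) f) ∎
    where
    scaled : ∀ {B} → Dist B → Dist B
    scaled = map (λ qb → (p * proj₁ qb , proj₂ qb))
    Ex-scaled : ∀ m′ → Ex (scaled m′) f ≡ p * Ex m′ f
    Ex-scaled []             = sym (*-zeroʳ p)
    Ex-scaled ((q , b) ∷ m′) = trans (cong (p * q * f b +_) (Ex-scaled m′))
      (solve 4 (λ p q x y → p :* q :* x :+ p :* y := p :* (q :* x :+ y)) refl p q (f b) (Ex m′ f))

  Supported : ∀ {A : Set} → (A → Set) → Dist A → Set
  Supported R m = All (λ pa → 0ℚ ≤ proj₁ pa × R (proj₂ pa)) m

  module _ {A : Set} {R : A → Set} where

    Supported-weaken : ∀ {S : A → Set} {m} → (∀ {a} → R a → S a) → Supported R m → Supported S m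
    Supported-weaken R⇒S = All.map (λ { (0≤p , r) → 0≤p , R⇒S r })

    Supported-++ : ∀ {m m′} → Supported R m → Supported R m′ → Supported R (m ++ m′)
    Supported-++ []       s′ = s′
    Supported-++ (x ∷ s)  s′ = x ∷ Supported-++ s s′

    Ex-cong-on : ∀ {m f g} → Supported R m → (∀ {a} → R a → f a ≡ g a) → Ex m f ≡ Ex m g
    Ex-cong-on {(p , a) ∷ m} ((_ , r) ∷ s) f≗g = cong₂ (λ x y → p * x + y) (f≗g r) (Ex-cong-on s f≗g)
    Ex-cong-on {[]}          []            f≗g = refl

    Ex-mono-on : ∀ {m f g} → Supported R m → (∀ {a} → R a → f a ≤ g a) → Ex m f ≤ Ex m g
    Ex-mono-on {[]}          []              f≤g = ≤-refl
    Ex-mono-on {(p , a) ∷ m} ((0≤p , r) ∷ s) f≤g =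
      +-mono-≤ (*-monoˡ-≤-nonNeg p {{nonNegative 0≤p}} (f≤g r)) (Ex-mono-on s f≤g)

    Ex-nonneg-on : ∀ {m f} → Supported R m → (∀ {a} → R a → 0ℚ ≤ f a) → 0ℚ ≤ Ex m f
    Ex-nonneg-on {m} s 0≤f = ≤-trans (≤-reflexive (sym (Ex-zero m))) (Ex-mono-on s 0≤f)

  Supported-return : ∀ {A} {R : A → Set} {a} → R a → Supported R (return a)
  Supported-return r = (≤ᵇ⇒≤ _ , r) ∷ []

  Supported-mapD : ∀ {A B} {R : B → Set} (g : A → B) {m} → Supported (λ a → R (g a)) m → Supported R (mapD g m)
  Supported-mapD g []      = []
  Supported-mapD g (x ∷ s) = x ∷ Supported-mapD g s

  Supported-bind : ∀ {A B} {R : A → Set} {S : B → Set} {m} (k : A → Dist B) →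
                   Supported R m → (∀ {a} → R a → Supported S (k a)) → Supported S (bind m k)
  Supported-bind k []                          k-ok = []
  Supported-bind k (_∷_ {x = p , a} (0≤p , r) s) k-ok = Supported-++ (scaled (k-ok r)) (Supported-bind k s k-ok)
    where
    scaled : ∀ {m′} → Supported _ m′ → Supported _ (map (λ qb → (p * proj₁ qb , proj₂ qb)) m′)
    scaled []                 = []
    scaled ((0≤q , r′) ∷ s′) = (*-nonneg 0≤p 0≤q , r′) ∷ scaled s′

  complement-nonneg : ∀ b → 0ℚ ≤ 1ℚ - 𝟙 b
  complement-nonneg true  = ≤ᵇ⇒≤ _
  complement-nonneg false = ≤ᵇ⇒≤ _

  complement-≤1 : ∀ b → 1ℚ - 𝟙 b ≤ 1ℚ
  complement-≤1 true  = ≤ᵇ⇒≤ _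
  complement-≤1 false = ≤ᵇ⇒≤ _

module Hypercube where

  open import Defs
  open RationalArithmetic using (fromℕ; fromℕ-suc; powℚ-+; *-nonneg)
  open import Data.Bool using (Bool; true; false; if_then_else_)
  import Data.Bool.Properties as BoolP
  open import Data.Nat as ℕ using (ℕ; zero; suc)
  import Data.Nat.Properties as ℕP
  open import Data.Nat.Combinatorics using (_C_)
  open BinomialBounds using (pascal)
  open import Data.Fin using (Fin; zero; suc)
  open import Data.Vec using (Vec; []; _∷_; lookup)
  import Data.Vec.Properties as VecP
  open import Data.Rational using (ℚ; 0ℚ; 1ℚ; _+_; _*_; _≤_)
  open import Data.Rational.Properties
  open import Data.List using (List; []; _∷_; map; _++_; concatMap; allFin; length)
  import Data.List.Properties as LP
  open import Data.List.Relation.Unary.All as All using (All; []; _∷_)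
  import Data.List.Relation.Unary.All.Properties as AllP
  open import Data.List.Relation.Unary.Any using (here)
  open import Data.List.Membership.Propositional using (_∈_)
  open import Data.List.Membership.Propositional.Properties using (∈-map⁺; ∈-map⁻; ∈-++⁺ˡ; ∈-++⁺ʳ)
  open import Data.List.Relation.Unary.Unique.Propositional using (Unique)
  import Data.List.Relation.Unary.Unique.Propositional.Properties as UniqueP
  import Data.List.Relation.Unary.AllPairs as AllPairs
  open import Data.Product using (_×_; _,_; ∃)
  open import Function using (_∘_; id)
  open import Relation.Nullary using (¬_; Dec; yes; does)
  open import Relation.Nullary.Decidable using (dec-true; dec-false)
  open import Relation.Binary.PropositionalEquality
  open import Data.Rational.Solver using (module +-*-Solver)
  open ≡-Reasoning

  weight : ∀ {n} → Vec Bool n → ℕ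
  weight []          = 0
  weight (true ∷ v)  = suc (weight v)
  weight (false ∷ v) = weight v

  zeros : ∀ {n} → Vec Bool n → ℕ
  zeros []          = 0
  zeros (true ∷ v)  = zeros v
  zeros (false ∷ v) = suc (zeros v)

  zeros+weight : ∀ {n} (v : Vec Bool n) → zeros v ℕ.+ weight v ≡ n
  zeros+weight []          = refl
  zeros+weight (true ∷ v)  = trans (ℕP.+-suc (zeros v) (weight v)) (cong suc (zeros+weight v))
  zeros+weight (false ∷ v) = cong suc (zeros+weight v)

  weight-flip-up : ∀ {n} (v : Vec Bool n) i → lookup v i ≡ false → weight (flipBit v i) ≡ suc (weight v)
  weight-flip-up (false ∷ v) zero    _  = refl
  weight-flip-up (true ∷ v)  zero    ()
  weight-flip-up (true ∷ v)  (suc i) vᵢ = cong suc (weight-flip-up v i vᵢ)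
  weight-flip-up (false ∷ v) (suc i) vᵢ = weight-flip-up v i vᵢ

  weight-flip-down : ∀ {n} (v : Vec Bool n) i → lookup v i ≡ true → suc (weight (flipBit v i)) ≡ weight v
  weight-flip-down (true ∷ v)  zero    _  = refl
  weight-flip-down (false ∷ v) zero    ()
  weight-flip-down (true ∷ v)  (suc i) vᵢ = cong suc (weight-flip-down v i vᵢ)
  weight-flip-down (false ∷ v) (suc i) vᵢ = weight-flip-down v i vᵢ

  =ᵥ⇒≡ : ∀ {d} {u v : Vertex d} → (u =ᵥ v) ≡ true → u ≡ v
  =ᵥ⇒≡ {u = u} {v} = reflects (VecP.≡-dec BoolP._≟_ u v)
    where
    reflects : (u≟v : Dec (u ≡ v)) → does u≟v ≡ true → u ≡ v
    reflects (yes u≡v) _ = u≡v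

  ≢⇒=ᵥ : ∀ {d} {u v : Vertex d} → ¬ u ≡ v → (u =ᵥ v) ≡ false
  ≢⇒=ᵥ {u = u} {v} = dec-false (VecP.≡-dec BoolP._≟_ u v)

  =ᵥ-refl : ∀ {d} (v : Vertex d) → (v =ᵥ v) ≡ true
  =ᵥ-refl v = dec-true (VecP.≡-dec BoolP._≟_ v v) refl

  allVertices-complete : ∀ {d} (v : Vertex d) → v ∈ allVertices d
  allVertices-complete []                = here refl
  allVertices-complete {suc d} (false ∷ v) = ∈-++⁺ˡ (∈-map⁺ (false ∷_) (allVertices-complete v))
  allVertices-complete {suc d} (true ∷ v)  = ∈-++⁺ʳ (map (false ∷_) (allVertices d)) (∈-map⁺ (true ∷_) (allVertices-complete v))

  allVertices-unique : ∀ d → Unique (allVertices d)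
  allVertices-unique zero    = [] AllPairs.∷ AllPairs.[]
  allVertices-unique (suc d) =
    UniqueP.++⁺ (UniqueP.map⁺ ∷-injectiveʳ (allVertices-unique d)) (UniqueP.map⁺ ∷-injectiveʳ (allVertices-unique d)) disjoint
    where
    ∷-injectiveʳ : ∀ {b} {x y : Vertex d} → b ∷ x ≡ b ∷ y → x ≡ y
    ∷-injectiveʳ refl = refl
    disjoint : ∀ {v} → ¬ (v ∈ map (false ∷_) (allVertices d) × v ∈ map (true ∷_) (allVertices d))
    disjoint (p , q) with ∈-map⁻ (false ∷_) p | ∈-map⁻ (true ∷_) q
    ... | _ , _ , refl | _ , _ , ()

  ∏ : ∀ {A : Set} → List A → (A → ℚ) → ℚ
  ∏ []       f = 1ℚ
  ∏ (x ∷ xs) f = f x * ∏ xs f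

  ∏-++ : ∀ {A : Set} (xs ys : List A) f → ∏ (xs ++ ys) f ≡ ∏ xs f * ∏ ys f
  ∏-++ []       ys f = sym (*-identityˡ _)
  ∏-++ (x ∷ xs) ys f = trans (cong (f x *_) (∏-++ xs ys f)) (sym (*-assoc (f x) _ _))

  ∏-map : ∀ {A B : Set} (g : A → B) (xs : List A) f → ∏ (map g xs) f ≡ ∏ xs (f ∘ g)
  ∏-map g []       f = refl
  ∏-map g (x ∷ xs) f = cong (f (g x) *_) (∏-map g xs f)

  ∏-cong : ∀ {A : Set} (xs : List A) {f g} → (∀ a → f a ≡ g a) → ∏ xs f ≡ ∏ xs g
  ∏-cong []       f≗g = refl
  ∏-cong (x ∷ xs) f≗g = cong₂ _*_ (f≗g x) (∏-cong xs f≗g)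

  ∏-cong-on : ∀ {A : Set} {xs : List A} {f g} → All (λ a → f a ≡ g a) xs → ∏ xs f ≡ ∏ xs g
  ∏-cong-on []           = refl
  ∏-cong-on (e ∷ es)     = cong₂ _*_ e (∏-cong-on es)

  ∏-one : ∀ {A : Set} (xs : List A) → ∏ xs (λ _ → 1ℚ) ≡ 1ℚ
  ∏-one []       = refl
  ∏-one (x ∷ xs) = cong (1ℚ *_) (∏-one xs)

  inLayer : ℕ → ∀ {d} → Vertex d → Bool
  inLayer h v = weight v ℕ.≡ᵇ h

  -- Layer h of the d-cube has C(d, h) vertices: the product over all vertices of
  -- r on layer h and 1 elsewhere is r^C(d,h).
  layer-product : ∀ d h r → ∏ (allVertices d) (λ v → if inLayer h v then r else 1ℚ) ≡ powℚ r (d C h)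
  layer-product zero    zero    r = refl
  layer-product zero    (suc h) r = refl
  layer-product (suc d) h       r = begin
    ∏ (map (false ∷_) V ++ map (true ∷_) V) F              ≡⟨ ∏-++ (map (false ∷_) V) (map (true ∷_) V) F ⟩
    ∏ (map (false ∷_) V) F * ∏ (map (true ∷_) V) F         ≡⟨ cong₂ _*_ (∏-map (false ∷_) V F) (∏-map (true ∷_) V F) ⟩
    ∏ V (F ∘ (false ∷_)) * ∏ V (F ∘ (true ∷_))             ≡⟨ split h ⟩
    powℚ r (suc d C h)                                     ∎
    where
    V = allVertices d
    F : Vertex (suc d) → ℚ
    F v = if inLayer h v then r else 1ℚ
    -- Pascal's rule: a vertex of layer h+1 either starts with 0 (layer h+1 below) or with 1 (layer h below)
    split : ∀ h → ∏ V (λ v → if inLayer h (false ∷ v) then r else 1ℚ) * ∏ V (λ v → if inLayer h (true ∷ v) then r else 1ℚ)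
                  ≡ powℚ r (suc d C h)
    split zero    = trans (cong₂ _*_ (layer-product d 0 r) (∏-one V)) (*-identityʳ _)
    split (suc h) = begin
      ∏ V (λ v → if inLayer (suc h) v then r else 1ℚ) * ∏ V (λ v → if inLayer h v then r else 1ℚ)
        ≡⟨ cong₂ _*_ (layer-product d (suc h) r) (layer-product d h r) ⟩
      powℚ r (d C suc h) * powℚ r (d C h)   ≡⟨ *-comm (powℚ r (d C suc h)) _ ⟩
      powℚ r (d C h) * powℚ r (d C suc h)   ≡⟨ sym (powℚ-+ r (d C h) (d C suc h)) ⟩
      powℚ r (d C h ℕ.+ d C suc h)          ≡⟨ cong (powℚ r) (sym (pascal d h)) ⟩
      powℚ r (suc d C suc h)                ∎

  map-allFin-suc : ∀ {A : Set} {n} (f : Fin (suc n) → A) → map f (allFin (suc n)) ≡ f zero ∷ map (f ∘ suc) (allFin n)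
  map-allFin-suc f = cong (f zero ∷_) (trans (LP.map-tabulate suc f) (sym (LP.map-tabulate id (f ∘ suc))))

  atZeros : ∀ {n} {E : Set} → Vec Bool n → (Fin n → E) → List E
  atZeros {n} v g = concatMap (λ i → if lookup v i then [] else (g i ∷ [])) (allFin n)

  length-atZeros : ∀ {n} {E : Set} (v : Vec Bool n) (g : Fin n → E) → length (atZeros v g) ≡ zeros v
  length-atZeros []      g = refl
  length-atZeros {E = E} (b ∷ v) g = begin
    length (atZeros (b ∷ v) g)                              ≡⟨ cong (length ∘ Data.List.concat) (map-allFin-suc (λ i → if lookup (b ∷ v) i then [] else (g i ∷ []))) ⟩
    length (head b ++ atZeros v (g ∘ suc))                  ≡⟨ LP.length-++ (head b) ⟩
    length (head b) ℕ.+ length (atZeros v (g ∘ suc))        ≡⟨ cong (length (head b) ℕ.+_) (length-atZeros v (g ∘ suc)) ⟩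
    length (head b) ℕ.+ zeros v                             ≡⟨ first b ⟩
    zeros (b ∷ v)                                           ∎
    where
    head : Bool → List E
    head b = if b then [] else (g zero ∷ [])
    first : ∀ b → length (head b) ℕ.+ zeros v ≡ zeros (b ∷ v)
    first true  = refl
    first false = refl

  atZeros-shape : ∀ {n} {E : Set} (v : Vec Bool n) (g : Fin n → E) → All (λ e → ∃ λ i → lookup v i ≡ false × e ≡ g i) (atZeros v g)
  atZeros-shape {n} v g = AllP.concat⁺ (AllP.map⁺ (AllP.tabulate⁺ at))
    where
    at : ∀ i → All (λ e → ∃ λ i → lookup v i ≡ false × e ≡ g i) (if lookup v i then [] else (g i ∷ []))
    at i with lookup v i in vᵢ
    ... | true  = []
    ... | false = (i , vᵢ , refl) ∷ []

  sum-atZeros : ∀ {n} (v : Vec Bool n) q → sumℚ (map (λ i → if lookup v i then 0ℚ else q) (allFin n)) ≡ q * fromℕ (zeros v)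
  sum-atZeros []      q = sym (*-zeroʳ q)
  sum-atZeros (b ∷ v) q = begin
    sumℚ (map (λ i → if lookup (b ∷ v) i then 0ℚ else q) (allFin _)) ≡⟨ cong sumℚ (map-allFin-suc (λ i → if lookup (b ∷ v) i then 0ℚ else q)) ⟩
    (if b then 0ℚ else q) + sumℚ (map (λ i → if lookup v i then 0ℚ else q) (allFin _)) ≡⟨ cong ((if b then 0ℚ else q) +_) (sum-atZeros v q) ⟩
    (if b then 0ℚ else q) + q * fromℕ (zeros v) ≡⟨ first b ⟩
    q * fromℕ (zeros (b ∷ v)) ∎
    where
    open +-*-Solver
    first : ∀ b → (if b then 0ℚ else q) + q * fromℕ (zeros v) ≡ q * fromℕ (zeros (b ∷ v))
    first true  = +-identityˡ _
    first false = trans (solve 2 (λ q z → q :+ q :* z := q :* (con 1ℚ :+ z)) refl q (fromℕ (zeros v)))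
                        (cong (q *_) (sym (fromℕ-suc (zeros v))))

  -- The edges of Defs grouped by their lower endpoint: edges d = concatMap upEdges (allVertices d).
  upEdges : ∀ {d} → Vertex d → List (Edge d)
  upEdges v = atZeros v (λ i → (v , flipBit v i))

  ∏-nonneg : ∀ {A : Set} (xs : List A) {f} → (∀ a → 0ℚ ≤ f a) → 0ℚ ≤ ∏ xs f
  ∏-nonneg []       0≤f = ≤ᵇ⇒≤ _
  ∏-nonneg (x ∷ xs) 0≤f = *-nonneg (0≤f x) (∏-nonneg xs 0≤f)

module IndependentRounding where

  open import Defs
  open Expectation
  open Hypercube using (∏; ∏-cong-on; upEdges; atZeros-shape)
  open import Data.Bool using (true; false; if_then_else_)
  open import Data.Nat using (ℕ)
  open import Data.Integer as ℤ using (ℤ)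
  open import Data.Rational as ℚ using (ℚ; 0ℚ; 1ℚ; _+_; _*_; _-_; -_)
  open import Data.Rational.Properties
  open import Data.List using (List; []; _∷_; map; _++_; concatMap)
  open import Data.List.Relation.Unary.All as All using (All; []; _∷_)
  import Data.List.Relation.Unary.All.Properties as AllP
  open import Data.List.Relation.Unary.Unique.Propositional using (Unique)
  import Data.List.Relation.Unary.AllPairs as AllPairs
  open import Data.Product using (_×_; _,_; proj₁; proj₂)
  open import Relation.Nullary using (¬_)
  open import Relation.Binary.PropositionalEquality
  open import Data.Rational.Solver using (module +-*-Solver)
  open ≡-Reasoning

  roundDist-total : ∀ y → Ex (roundDist y) (λ _ → 1ℚ) ≡ 1ℚ
  roundDist-total y = solve 1 (λ f → f :* con 1ℚ :+ ((con 1ℚ :- f) :* con 1ℚ :+ con 0ℚ) := con 1ℚ) refl (frac y)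
    where open +-*-Solver

  Sample : ℕ → Set
  Sample d = Edge d × ℤ

  module _ {d : ℕ} (x : Load d) where

    edgeFlow-total : ∀ e → Ex (edgeFlow x e) (λ _ → 1ℚ) ≡ 1ℚ
    edgeFlow-total (a , b) = oriented (0ℚ ℚ.≤ᵇ y)
      where
      y = offDiag d * toℚ (x a) - offDiag d * toℚ (x b)
      oriented : ∀ c → Ex (if c then roundDist y else mapD ℤ.-_ (roundDist (- y))) (λ _ → 1ℚ) ≡ 1ℚ
      oriented true  = roundDist-total y
      oriented false = trans (Ex-mapD ℤ.-_ (roundDist (- y)) (λ _ → 1ℚ)) (roundDist-total (- y))

    Ex-flows-∷ : ∀ e es F → Ex (flowsDist x (e ∷ es)) F ≡ Ex (edgeFlow x e) (λ f → Ex (flowsDist x es) (λ l → F ((e , f) ∷ l)))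
    Ex-flows-∷ e es F = trans (Ex-bind (edgeFlow x e) (λ f → mapD ((e , f) ∷_) (flowsDist x es)) F)
                              (Ex-cong (edgeFlow x e) (λ f → Ex-mapD ((e , f) ∷_) (flowsDist x es) F))

    flows-total : ∀ es → Ex (flowsDist x es) (λ _ → 1ℚ) ≡ 1ℚ
    flows-total []       = Ex-return {A = List (Sample d)} [] (λ _ → 1ℚ)
    flows-total (e ∷ es) = trans (Ex-flows-∷ e es (λ _ → 1ℚ))
                                 (trans (Ex-cong (edgeFlow x e) (λ _ → flows-total es)) (edgeFlow-total e))

    flows-++ : ∀ es fs F → Ex (flowsDist x (es ++ fs)) F ≡ Ex (flowsDist x es) (λ l₁ → Ex (flowsDist x fs) (λ l₂ → F (l₁ ++ l₂)))
    flows-++ []       fs F = sym (Ex-return {A = List (Sample d)} [] (λ l₁ → Ex (flowsDist x fs) (λ l₂ → F (l₁ ++ l₂))))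
    flows-++ (e ∷ es) fs F = begin
      Ex (flowsDist x (e ∷ es ++ fs)) F
        ≡⟨ Ex-flows-∷ e (es ++ fs) F ⟩
      Ex (edgeFlow x e) (λ f → Ex (flowsDist x (es ++ fs)) (λ l → F ((e , f) ∷ l)))
        ≡⟨ Ex-cong (edgeFlow x e) (λ f → flows-++ es fs (λ l → F ((e , f) ∷ l))) ⟩
      Ex (edgeFlow x e) (λ f → Ex (flowsDist x es) (λ l₁ → Ex (flowsDist x fs) (λ l₂ → F ((e , f) ∷ l₁ ++ l₂))))
        ≡⟨ sym (Ex-flows-∷ e es (λ l₁ → Ex (flowsDist x fs) (λ l₂ → F (l₁ ++ l₂)))) ⟩
      Ex (flowsDist x (e ∷ es)) (λ l₁ → Ex (flowsDist x fs) (λ l₂ → F (l₁ ++ l₂))) ∎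

    FlowsOn : List (Edge d) → (Edge d → ℤ → Set) → List (Sample d) → Set
    FlowsOn es R l = map proj₁ l ≡ es × All (λ s → R (proj₁ s) (proj₂ s)) l

    flows-support : ∀ {R} es → All (λ e → Supported (R e) (edgeFlow x e)) es → Supported (FlowsOn es R) (flowsDist x es)
    flows-support []       []         = Supported-return (refl , [])
    flows-support (e ∷ es) (ok ∷ oks) =
      Supported-bind (λ f → mapD ((e , f) ∷_) (flowsDist x es)) ok λ r →
        Supported-mapD ((e , _) ∷_) (Supported-weaken (λ { (eq , rs) → cong (e ∷_) eq , r ∷ rs }) (flows-support es oks))

    FlowsOn-edges : ∀ {es R l} {P : Edge d → Set} → FlowsOn es R l → All P es → All (λ s → P (proj₁ s)) l
    FlowsOn-edges (refl , _) ps = AllP.map⁻ ps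

    upEdges-from : ∀ (u : Vertex d) → All (λ e → proj₁ e ≡ u) (upEdges u)
    upEdges-from u = All.map (λ { (_ , _ , refl) → refl }) (atZeros-shape u (λ i → (u , flipBit u i)))

    upEdges-not-from : ∀ (u : Vertex d) vs → All (λ v → ¬ u ≡ v) vs → All (λ e → ¬ proj₁ e ≡ u) (concatMap upEdges vs)
    upEdges-not-from u []       []          = []
    upEdges-not-from u (v ∷ vs) (u≢v ∷ u∉) =
      AllP.++⁺ (All.map (λ { {e} refl e₁≡u → u≢v (sym e₁≡u) }) (upEdges-from v)) (upEdges-not-from u vs u∉)

    LocalAt : Vertex d → (List (Sample d) → ℚ) → Set
    LocalAt v F = ∀ l₁ l₂ → (All (λ s → ¬ proj₁ (proj₁ s) ≡ v) l₂ → F (l₁ ++ l₂) ≡ F l₁)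
                          × (All (λ s → ¬ proj₁ (proj₁ s) ≡ v) l₁ → F (l₁ ++ l₂) ≡ F l₂)

    factorise : ∀ {R} (f : Vertex d → List (Sample d) → ℚ) → (∀ v → LocalAt v (f v)) →
                ∀ vs → Unique vs → All (λ e → Supported (R e) (edgeFlow x e)) (concatMap upEdges vs) →
                Ex (flowsDist x (concatMap upEdges vs)) (λ l → ∏ vs (λ v → f v l))
                  ≡ ∏ vs (λ v → Ex (flowsDist x (upEdges v)) (f v))
    factorise f local []       _                   _  = Ex-return {A = List (Sample d)} [] (λ _ → 1ℚ)
    factorise {R} f local (u ∷ vs) (u∉vs AllPairs.∷ unique) ok = begin
      Ex (flowsDist x (U ++ W)) (λ l → ∏ (u ∷ vs) (λ v → f v l))
        ≡⟨ flows-++ U W (λ l → ∏ (u ∷ vs) (λ v → f v l)) ⟩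
      Ex (flowsDist x U) (λ l₁ → Ex (flowsDist x W) (λ l₂ → ∏ (u ∷ vs) (λ v → f v (l₁ ++ l₂))))
        ≡⟨ Ex-cong-on supportU (λ on₁ → Ex-cong-on supportW (λ on₂ → split on₁ on₂)) ⟩
      Ex (flowsDist x U) (λ l₁ → Ex (flowsDist x W) (λ l₂ → f u l₁ * ∏ vs (λ v → f v l₂)))
        ≡⟨ Ex-cong (flowsDist x U) (λ l₁ → Ex-*ˡ (flowsDist x W) (f u l₁) (λ l₂ → ∏ vs (λ v → f v l₂))) ⟩
      Ex (flowsDist x U) (λ l₁ → f u l₁ * Ex (flowsDist x W) (λ l₂ → ∏ vs (λ v → f v l₂)))
        ≡⟨ Ex-*ʳ (flowsDist x U) _ (f u) ⟩
      Ex (flowsDist x U) (f u) * Ex (flowsDist x W) (λ l₂ → ∏ vs (λ v → f v l₂))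
        ≡⟨ cong (Ex (flowsDist x U) (f u) *_) (factorise f local vs unique okW) ⟩
      Ex (flowsDist x U) (f u) * ∏ vs (λ v → Ex (flowsDist x (upEdges v)) (f v)) ∎
      where
      U = upEdges u
      W = concatMap upEdges vs
      okU = AllP.++⁻ˡ U ok
      okW = AllP.++⁻ʳ U ok
      supportU = flows-support U okU
      supportW = flows-support W okW
      split : ∀ {l₁ l₂} → FlowsOn U R l₁ → FlowsOn W R l₂ →
              ∏ (u ∷ vs) (λ v → f v (l₁ ++ l₂)) ≡ f u l₁ * ∏ vs (λ v → f v l₂)
      split {l₁} {l₂} on₁ on₂ = cong₂ _*_
        (proj₁ (local u l₁ l₂) (FlowsOn-edges on₂ (upEdges-not-from u vs u∉vs)))
        (∏-cong-on (All.map (λ {v} u≢v → proj₂ (local v l₁ l₂)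
          (All.map (λ { {s} refl s₁≡v → u≢v s₁≡v }) (FlowsOn-edges on₁ (upEdges-from u)))) u∉vs))

module MiddleLayer where

  open import Defs
  open RationalArithmetic
  open Expectation
  open Hypercube
  open IndependentRounding
  open import Data.Bool using (Bool; true; false; not; if_then_else_; _∨_; _∧_; T)
  import Data.Bool.Properties as BoolP
  open import Data.Nat as ℕ using (ℕ; zero; suc)
  open import Data.Nat.Combinatorics using (_C_)
  import Data.Nat.Properties as ℕP
  open import Data.Integer as ℤ using (ℤ)
  open import Data.Fin using (Fin)
  open import Data.Vec using (lookup)
  open import Data.Rational as ℚ using (ℚ; 0ℚ; 1ℚ; ½; _+_; _*_; _-_; _≤_; -_)
  open import Data.Rational.Properties
  open import Data.List using (List; []; _∷_; map; _++_; concatMap; allFin; length)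
  import Data.List.Properties as LP
  open import Data.List.Relation.Unary.All as All using (All; []; _∷_)
  import Data.List.Relation.Unary.All.Properties as AllP
  open import Relation.Binary.Definitions using (Tri; tri<; tri≈; tri>)
  open import Data.Product using (_×_; _,_; proj₁; proj₂)
  open import Relation.Nullary using (¬_)
  import Data.List.Relation.Unary.Any as Any
  open import Data.List.Relation.Unary.Any.Properties using (any⁺)
  open import Function.Bundles using (Equivalence)
  open import Data.Empty using (⊥-elim)
  open import Relation.Binary.PropositionalEquality

  -- A fair coin deciding whether one unit flows backwards along an edge.
  coin : Dist ℤ
  coin = mapD ℤ.-_ (roundDist ½)

  zero-support : ∀ {R : ℤ → Set} → R (ℤ.+ 0) → Supported R (roundDist 0ℚ)
  zero-support r = (≤ᵇ⇒≤ _ , r) ∷ (≤ᵇ⇒≤ _ , r) ∷ []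

  coin-support : ∀ {R : ℤ → Set} → (∀ {f} → R f) → Supported R coin
  coin-support r = (≤ᵇ⇒≤ _ , r) ∷ (≤ᵇ⇒≤ _ , r) ∷ []

  edgeFlow-balanced : ∀ {d} (x : Load d) a b → x a ≡ x b → edgeFlow x (a , b) ≡ roundDist 0ℚ
  edgeFlow-balanced {d} x a b xa≡xb =
    cong (λ y → if 0ℚ ℚ.≤ᵇ y then roundDist y else mapD ℤ.-_ (roundDist (- y)))
         (trans (cong (λ z → offDiag d * toℚ (x a) - offDiag d * toℚ z) (sym xa≡xb)) (+-inverseʳ (offDiag d * toℚ (x a))))

  edgeFlow-coin : ∀ {k} (x : Load (suc k)) a b → x a ≡ ℤ.+ 0 → x b ≡ ℤ.+ suc k → edgeFlow x (a , b) ≡ coin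
  edgeFlow-coin {k} x a b xa≡0 xb≡d =
    cong (λ y → if 0ℚ ℚ.≤ᵇ y then roundDist y else mapD ℤ.-_ (roundDist (- y))) (begin
      offDiag (suc k) * toℚ (x a) - offDiag (suc k) * toℚ (x b)    ≡⟨ cong₂ (λ u w → offDiag (suc k) * toℚ u - offDiag (suc k) * toℚ w) xa≡0 xb≡d ⟩
      offDiag (suc k) * 0ℚ - offDiag (suc k) * fromℕ (suc k)        ≡⟨ cong₂ _-_ (*-zeroʳ (offDiag (suc k))) (offDiag-degree k) ⟩
      - ½                                                           ∎)
    where open ≡-Reasoning

  isZero : ℤ → Bool
  isZero (ℤ.+ zero) = true
  isZero _          = false

  isZero⇒ : ∀ z → T (isZero z) → z ≡ ℤ.+ 0
  isZero⇒ (ℤ.+ zero) _ = refl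

  ¬T⇒≡false : ∀ {b} → ¬ T b → b ≡ false
  ¬T⇒≡false {false} _  = refl
  ¬T⇒≡false {true}  ¬t = ⊥-elim (¬t _)

  module Construction (k h : ℕ) where

    d : ℕ
    d = suc k

    initialLoad : Vertex d → ℕ
    initialLoad v = if h ℕ.<ᵇ weight v then d else 0

    X : Load d
    X v = ℤ.+ initialLoad v

    ξ₀ : IdealLoad d
    ξ₀ v = toℚ (X v)

    -- The centers: vertices of layer h, empty but with all upper neighbors loaded.
    center : Vertex d → Bool
    center = inLayer h

    center⇒weight : ∀ v → center v ≡ true → weight v ≡ h
    center⇒weight v c = ℕP.≡ᵇ⇒≡ (weight v) h (subst T (sym c) _)

    load-above : ∀ v → h ℕ.< weight v → X v ≡ ℤ.+ d
    load-above v h<w = cong (λ b → ℤ.+ (if b then d else 0)) (Equivalence.to BoolP.T-≡ (ℕP.<⇒<ᵇ h<w))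

    load-below : ∀ v → weight v ℕ.≤ h → X v ≡ ℤ.+ 0
    load-below v w≤h = cong (λ b → ℤ.+ (if b then d else 0)) (¬T⇒≡false (λ t → ℕP.<⇒≱ (ℕP.<ᵇ⇒< h (weight v) t) w≤h))

    -- Along an upward edge (a , a ⊕ eᵢ) the flow vanishes unless a is a center,
    -- in which case it is a fair coin; in particular flows into centers vanish.
    IntoCenterZero : Edge d → ℤ → Set
    IntoCenterZero e f = center (proj₂ e) ≡ true → f ≡ ℤ.+ 0

    module _ (a : Vertex d) (i : Fin d) (aᵢ : lookup a i ≡ false) where

      private
        b = flipBit a i
        weight-b : weight b ≡ suc (weight a)
        weight-b = weight-flip-up a i aᵢ

      center-upEdge-coin : center a ≡ true → edgeFlow X (a , b) ≡ coin
      center-upEdge-coin c = edgeFlow-coin X a b (load-below a (ℕP.≤-reflexive (center⇒weight a c)))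
        (load-above b (ℕP.≤-reflexive (sym (trans weight-b (cong suc (center⇒weight a c))))))

      upEdge-support : Supported (IntoCenterZero (a , b)) (edgeFlow X (a , b))
      upEdge-support = by-layer (ℕP.<-cmp (weight a) h)
        where
        by-layer : Tri (weight a ℕ.< h) (weight a ≡ h) (h ℕ.< weight a) → Supported (IntoCenterZero (a , b)) (edgeFlow X (a , b))
        by-layer (tri< w<h _ _) = subst (Supported (IntoCenterZero (a , b))) (sym (edgeFlow-balanced X a b
              (trans (load-below a (ℕP.<⇒≤ w<h)) (sym (load-below b (ℕP.≤-trans (ℕP.≤-reflexive weight-b) w<h))))))
              (zero-support (λ _ → refl))
        by-layer (tri> _ _ h<w) = subst (Supported (IntoCenterZero (a , b))) (sym (edgeFlow-balanced X a b
              (trans (load-above a h<w) (sym (load-above b (ℕP.<-trans h<w (ℕP.≤-reflexive (sym weight-b))))))))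
              (zero-support (λ _ → refl))
        by-layer (tri≈ _ w≡h _) = subst (Supported (IntoCenterZero (a , b))) (sym (edgeFlow-coin X a b (load-below a (ℕP.≤-reflexive w≡h))
              (load-above b (ℕP.≤-reflexive (sym (trans weight-b (cong suc w≡h)))))))
              (coin-support b-not-center)
          where
          b-not-center : ∀ {f} → IntoCenterZero (a , b) f
          b-not-center c = ⊥-elim (ℕP.1+n≢n (trans (sym (trans weight-b (cong suc w≡h))) (center⇒weight b c)))

    edges-support : ∀ vs → All (λ e → Supported (IntoCenterZero e) (edgeFlow X e)) (concatMap upEdges vs)
    edges-support []       = []
    edges-support (v ∷ vs) = AllP.++⁺ (All.map (λ { (i , vᵢ , refl) → upEdge-support v i vᵢ }) (atZeros-shape v _)) (edges-support vs)

    -- After one step the idealized process has moved ½ token to a center from each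
    -- of its loaded upper neighbors (one per zero coordinate), and none from below.
    neighbor-inflow : ∀ v i → center v ≡ true → offDiag d * ξ₀ (flipBit v i) ≡ (if lookup v i then 0ℚ else ½)
    neighbor-inflow v i c with lookup v i in vᵢ
    ... | true  = trans (cong (λ z → offDiag d * toℚ z) (load-below (flipBit v i)
                    (ℕP.≤-trans (ℕP.n≤1+n _) (ℕP.≤-reflexive (trans (weight-flip-down v i vᵢ) (center⇒weight v c))))))
                  (*-zeroʳ (offDiag d))
    ... | false = trans (cong (λ z → offDiag d * toℚ z) (load-above (flipBit v i)
                    (ℕP.≤-reflexive (sym (trans (weight-flip-up v i vᵢ) (cong suc (center⇒weight v c)))))))
                  (offDiag-degree k)

    ideal-at-center : ∀ v → center v ≡ true → ideal ξ₀ 1 v ≡ ½ * fromℕ (zeros v)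
    ideal-at-center v c = begin
      ½ * ξ₀ v + sumℚ (map (λ i → offDiag d * ξ₀ (flipBit v i)) (allFin d))
        ≡⟨ cong₂ (λ z s → ½ * toℚ z + s) (load-below v (ℕP.≤-reflexive (center⇒weight v c)))
                 (cong sumℚ (LP.map-cong (λ i → neighbor-inflow v i c) (allFin d))) ⟩
      ½ * 0ℚ + sumℚ (map (λ i → if lookup v i then 0ℚ else ½) (allFin d))
        ≡⟨ trans (+-identityˡ _) (sum-atZeros v ½) ⟩
      ½ * fromℕ (zeros v) ∎
      where open ≡-Reasoning

    quiet : Vertex d → List (Sample d) → Bool
    quiet v []                  = true
    quiet v (((a , _) , f) ∷ l) = (not (a =ᵥ v) ∨ isZero f) ∧ quiet v l

    quiet-++ : ∀ v l₁ l₂ → quiet v (l₁ ++ l₂) ≡ quiet v l₁ ∧ quiet v l₂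
    quiet-++ v []                  l₂ = refl
    quiet-++ v (((a , _) , f) ∷ l₁) l₂ =
      trans (cong ((not (a =ᵥ v) ∨ isZero f) ∧_) (quiet-++ v l₁ l₂)) (sym (BoolP.∧-assoc (not (a =ᵥ v) ∨ isZero f) _ _))

    quiet-elsewhere : ∀ v l → All (λ s → ¬ proj₁ (proj₁ s) ≡ v) l → quiet v l ≡ true
    quiet-elsewhere v []       []          = refl
    quiet-elsewhere v (s ∷ l) (a≢v ∷ a≢vs) rewrite ≢⇒=ᵥ a≢v = quiet-elsewhere v l a≢vs

    outflow : Vertex d → Sample d → ℤ
    outflow v ((a , b) , f) = if a =ᵥ v then f else (if b =ᵥ v then ℤ.- f else ℤ.+ 0)

    outflow-zero : ∀ v s → center v ≡ true → IntoCenterZero (proj₁ s) (proj₂ s) →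
                   T (not (proj₁ (proj₁ s) =ᵥ v) ∨ isZero (proj₂ s)) → outflow v s ≡ ℤ.+ 0
    outflow-zero v ((a , b) , f) c into t with a =ᵥ v in a≟v
    ... | true  = isZero⇒ f t
    ... | false with b =ᵥ v in b≟v
    ...   | true  = cong ℤ.-_ (into (trans (cong center (=ᵥ⇒≡ {u = b} {v} b≟v)) c))
    ...   | false = refl

    quiet-center-empty : ∀ v l → center v ≡ true → All (λ s → IntoCenterZero (proj₁ s) (proj₂ s)) l →
                         T (quiet v l) → applyFlows X l v ≡ ℤ.+ 0
    quiet-center-empty v l c into q = cong₂ ℤ._-_ (load-below v (ℕP.≤-reflexive (center⇒weight v c))) (no-outflow l into q)
      where
      no-outflow : ∀ l → All (λ s → IntoCenterZero (proj₁ s) (proj₂ s)) l → T (quiet v l) → sumℤ (map (outflow v) l) ≡ ℤ.+ 0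
      no-outflow []      []            _ = refl
      no-outflow (s ∷ l) (into ∷ intos) q with Equivalence.to BoolP.T-∧ q
      ... | q₁ , q₂ = cong₂ ℤ._+_ (outflow-zero v s c into q₁) (no-outflow l intos q₂)

    -- A quiet center with at least d/2 zeros witnesses a deviation of at least d/4:
    -- its discrete load is 0 while the idealized load is ½ zeros v.
    quiet-center-deviates : ∀ v l → center v ≡ true → d ℕ.≤ zeros v ℕ.+ zeros v →
                            All (λ s → IntoCenterZero (proj₁ s) (proj₂ s)) l → T (quiet v l) →
                            T (deviates (applyFlows X l) (ideal ξ₀ 1))
    quiet-center-deviates v l c d≤2z into q =
      any⁺ _ (Any.map (λ { refl → ≤⇒≤ᵇ (≤-trans (quarter-≤-half d (zeros v) d≤2z) (≤-reflexive (sym gap))) }) (allVertices-complete v))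
      where
      open ≡-Reasoning
      gap : ℚ.∣ toℚ (applyFlows X l v) - ideal ξ₀ 1 v ∣ ≡ ½ * fromℕ (zeros v)
      gap = begin
        ℚ.∣ toℚ (applyFlows X l v) - ideal ξ₀ 1 v ∣  ≡⟨ cong₂ (λ a b → ℚ.∣ toℚ a - b ∣) (quiet-center-empty v l c into q) (ideal-at-center v c) ⟩
        ℚ.∣ 0ℚ - ½ * fromℕ (zeros v) ∣             ≡⟨ cong ℚ.∣_∣ (+-identityˡ (- (½ * fromℕ (zeros v)))) ⟩
        ℚ.∣ - (½ * fromℕ (zeros v)) ∣              ≡⟨ ∣-p∣≡∣p∣ (½ * fromℕ (zeros v)) ⟩
        ℚ.∣ ½ * fromℕ (zeros v) ∣                  ≡⟨ 0≤p⇒∣p∣≡p (*-nonneg {½} (≤ᵇ⇒≤ _) (fromℕ-nonneg (zeros v))) ⟩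
        ½ * fromℕ (zeros v)                        ∎

    -- The factor 1 - [v quiet] at a center v, and 1 elsewhere; it only depends on
    -- the upward edges of v.
    noisy : Vertex d → List (Sample d) → ℚ
    noisy v l = if center v then 1ℚ - 𝟙 (quiet v l) else 1ℚ

    noisy-local : ∀ v → LocalAt X v (noisy v)
    noisy-local v l₁ l₂ =
      (λ elsewhere₂ → cong (λ q → if center v then 1ℚ - 𝟙 q else 1ℚ)
         (trans (quiet-++ v l₁ l₂) (trans (cong (quiet v l₁ ∧_) (quiet-elsewhere v l₂ elsewhere₂)) (BoolP.∧-identityʳ _)))) ,
      (λ elsewhere₁ → cong (λ q → if center v then 1ℚ - 𝟙 q else 1ℚ)
         (trans (quiet-++ v l₁ l₂) (cong (_∧ quiet v l₂) (quiet-elsewhere v l₁ elsewhere₁))))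

    quiet-probability : ∀ v es → All (λ e → proj₁ e ≡ v × edgeFlow X e ≡ coin) es →
                        Ex (flowsDist X es) (λ l → 𝟙 (quiet v l)) ≡ powℚ ½ (length es)
    quiet-probability v []       []                    = refl
    quiet-probability v (e ∷ es) ((refl , coin≡) ∷ cs) = begin
      Ex (flowsDist X (e ∷ es)) (λ l → 𝟙 (quiet v l))          ≡⟨ Ex-flows-∷ X e es (λ l → 𝟙 (quiet v l)) ⟩
      Ex (edgeFlow X e) after                                  ≡⟨ cong (λ m → Ex m after) coin≡ ⟩
      ½ * after (ℤ.- ℤ.+ 1) + (½ * after (ℤ.+ 0) + 0ℚ)          ≡⟨ cong₂ (λ p q → ½ * p + (½ * q + 0ℚ)) after-moved after-stayed ⟩
      ½ * 0ℚ + (½ * powℚ ½ (length es) + 0ℚ)                   ≡⟨ trans (cong (_+ (½ * powℚ ½ (length es) + 0ℚ)) (*-zeroʳ ½)) (trans (+-identityˡ _) (+-identityʳ _)) ⟩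
      powℚ ½ (length (e ∷ es))                                 ∎
      where
      open ≡-Reasoning
      after : ℤ → ℚ
      after f = Ex (flowsDist X es) (λ l → 𝟙 (quiet v ((e , f) ∷ l)))
      first-quiet : ∀ f l → quiet v ((e , f) ∷ l) ≡ isZero f ∧ quiet v l
      first-quiet f l = cong (λ t → (not t ∨ isZero f) ∧ quiet v l) (=ᵥ-refl v)
      after-moved : after (ℤ.- ℤ.+ 1) ≡ 0ℚ
      after-moved = trans (Ex-cong (flowsDist X es) (λ l → cong 𝟙 (first-quiet (ℤ.- ℤ.+ 1) l))) (Ex-zero (flowsDist X es))
      after-stayed : after (ℤ.+ 0) ≡ powℚ ½ (length es)
      after-stayed = trans (Ex-cong (flowsDist X es) (λ l → cong 𝟙 (first-quiet (ℤ.+ 0) l))) (quiet-probability v es cs)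

    noisy-expectation : ∀ v → Ex (flowsDist X (upEdges v)) (noisy v) ≡ (if center v then 1ℚ - powℚ ½ (zeros v) else 1ℚ)
    noisy-expectation v with center v in c
    ... | false = flows-total X (upEdges v)
    ... | true  = begin
      Ex (flowsDist X (upEdges v)) (λ l → 1ℚ - 𝟙 (quiet v l))                      ≡⟨ Ex-- (flowsDist X (upEdges v)) (λ _ → 1ℚ) (λ l → 𝟙 (quiet v l)) ⟩
      Ex (flowsDist X (upEdges v)) (λ _ → 1ℚ) - Ex (flowsDist X (upEdges v)) (λ l → 𝟙 (quiet v l))
        ≡⟨ cong₂ _-_ (flows-total X (upEdges v)) (quiet-probability v (upEdges v) coins) ⟩
      1ℚ - powℚ ½ (length (upEdges v))                                             ≡⟨ cong (λ n → 1ℚ - powℚ ½ n) (length-atZeros v _) ⟩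
      1ℚ - powℚ ½ (zeros v)                                                        ∎
      where
      open ≡-Reasoning
      coins : All (λ e → proj₁ e ≡ v × edgeFlow X e ≡ coin) (upEdges v)
      coins = All.map (λ { (i , vᵢ , refl) → refl , center-upEdge-coin v i vᵢ c }) (atZeros-shape v _)

    step : Load d × Bool → Dist (Load d × Bool)
    step xb = mapD (λ x′ → (x′ , proj₂ xb ∨ deviates x′ (ideal ξ₀ 1))) (discreteStep (proj₁ xb))

    flag : Load d × Bool → ℚ
    flag xb = 𝟙 (proj₂ xb)

    deviates₁ : List (Sample d) → Bool
    deviates₁ l = deviates (applyFlows X l) (ideal ξ₀ 1)

    deviation-one-step : ∀ b₀ → prob proj₂ (bind (return (X , b₀)) step) ≡ Ex (flowsDist X (edges d)) (λ l → 𝟙 (b₀ ∨ deviates₁ l))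
    deviation-one-step b₀ = begin
      prob proj₂ (bind (return (X , b₀)) step)                     ≡⟨ prob-Ex proj₂ (bind (return (X , b₀)) step) ⟩
      Ex (bind (return (X , b₀)) step) flag                        ≡⟨ Ex-bind (return (X , b₀)) step flag ⟩
      Ex (return (X , b₀)) (λ xb → Ex (step xb) flag)              ≡⟨ Ex-return (X , b₀) (λ xb → Ex (step xb) flag) ⟩
      Ex (step (X , b₀)) flag                                      ≡⟨ Ex-mapD (λ x′ → (x′ , b₀ ∨ deviates x′ (ideal ξ₀ 1))) (discreteStep X) flag ⟩
      Ex (discreteStep X) (λ x′ → 𝟙 (b₀ ∨ deviates x′ (ideal ξ₀ 1))) ≡⟨ Ex-mapD (applyFlows X) (flowsDist X (edges d)) (λ x′ → 𝟙 (b₀ ∨ deviates x′ (ideal ξ₀ 1))) ⟩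
      Ex (flowsDist X (edges d)) (λ l → 𝟙 (b₀ ∨ deviates₁ l))      ∎
      where open ≡-Reasoning

    noisy-one : ∀ v l → (center v ≡ true → quiet v l ≡ false) → noisy v l ≡ 1ℚ
    noisy-one v l = by-cases (center v) (quiet v l)
      where
      by-cases : ∀ c q → (c ≡ true → q ≡ false) → (if c then 1ℚ - 𝟙 q else 1ℚ) ≡ 1ℚ
      by-cases false q _     = refl
      by-cases true  q c⇒¬q = cong (λ q → 1ℚ - 𝟙 q) (c⇒¬q refl)

    noisy-nonneg : ∀ v l → 0ℚ ≤ noisy v l
    noisy-nonneg v l with center v
    ... | true  = complement-nonneg (quiet v l)
    ... | false = ≤ᵇ⇒≤ _

    -- Pointwise: without a deviation every center must be noisy, so the product
    -- of the factors dominates the no-deviation indicator.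
    no-deviation-≤-noisy : ∀ c → (∀ v → center v ≡ true → zeros v ≡ c) → d ℕ.≤ c ℕ.+ c →
      ∀ b₀ l → All (λ s → IntoCenterZero (proj₁ s) (proj₂ s)) l →
      1ℚ - 𝟙 (b₀ ∨ deviates₁ l) ≤ ∏ (allVertices d) (λ v → noisy v l)
    no-deviation-≤-noisy c zeros≡c d≤2c b₀ l into = by-deviation (deviates₁ l) refl
      where
      quiet⇒deviates : ∀ v → center v ≡ true → T (quiet v l) → T (deviates₁ l)
      quiet⇒deviates v cv = quiet-center-deviates v l cv (subst (λ z → d ℕ.≤ z ℕ.+ z) (sym (zeros≡c v cv)) d≤2c) into
      all-noisy : deviates₁ l ≡ false → ∀ v → noisy v l ≡ 1ℚ
      all-noisy calm v = noisy-one v l (λ cv → ¬T⇒≡false (λ q → subst T calm (quiet⇒deviates v cv q)))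
      by-deviation : ∀ t → deviates₁ l ≡ t → 1ℚ - 𝟙 (b₀ ∨ deviates₁ l) ≤ ∏ (allVertices d) (λ v → noisy v l)
      by-deviation true  dev = ≤-trans (≤-reflexive (cong (λ t → 1ℚ - 𝟙 (b₀ ∨ t)) dev))
        (≤-trans (≤-reflexive (cong (λ t → 1ℚ - 𝟙 t) (BoolP.∨-zeroʳ b₀))) (∏-nonneg (allVertices d) (λ v → noisy-nonneg v l)))
      by-deviation false calm = ≤-trans (complement-≤1 (b₀ ∨ deviates₁ l))
        (≤-reflexive (sym (trans (∏-cong (allVertices d) (all-noisy calm)) (∏-one (allVertices d)))))

    failure-as-expectation : 1ℚ - probDeviationBy X 1 ≡ Ex (flowsDist X (edges d)) (λ l → 1ℚ - 𝟙 (deviates X ξ₀ ∨ deviates₁ l))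
    failure-as-expectation = begin
      1ℚ - probDeviationBy X 1                                   ≡⟨ cong (λ p → 1ℚ - p) (deviation-one-step b₀) ⟩
      1ℚ - Ex flows (λ l → 𝟙 (b₀ ∨ deviates₁ l))                 ≡⟨ cong (_- Ex flows (λ l → 𝟙 (b₀ ∨ deviates₁ l))) (sym (flows-total X (edges d))) ⟩
      Ex flows (λ _ → 1ℚ) - Ex flows (λ l → 𝟙 (b₀ ∨ deviates₁ l)) ≡⟨ sym (Ex-- flows (λ _ → 1ℚ) (λ l → 𝟙 (b₀ ∨ deviates₁ l))) ⟩
      Ex flows (λ l → 1ℚ - 𝟙 (b₀ ∨ deviates₁ l))                 ∎
      where
      open ≡-Reasoning
      flows = flowsDist X (edges d)
      b₀ = deviates X ξ₀

    -- Every center has c zeros and d ≤ 2c: then the probability of seeing no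
    -- deviation of d/4 by time 1 is at most (1 - ½ᶜ)^C(d,h), one independent
    -- factor per center.
    failure-probability : ∀ c → (∀ v → center v ≡ true → zeros v ≡ c) → d ℕ.≤ c ℕ.+ c →
      0ℚ ≤ 1ℚ - probDeviationBy X 1 × 1ℚ - probDeviationBy X 1 ≤ powℚ (1ℚ - powℚ ½ c) (d C h)
    failure-probability c zeros≡c d≤2c = subst (λ F → 0ℚ ≤ F × F ≤ powℚ r (d C h)) (sym failure-as-expectation)
      (Ex-nonneg-on support (λ {l} _ → complement-nonneg (b₀ ∨ deviates₁ l)) , (begin
        Ex flows (λ l → 1ℚ - 𝟙 (b₀ ∨ deviates₁ l))          ≤⟨ Ex-mono-on support (λ { {l} (_ , into) → no-deviation-≤-noisy c zeros≡c d≤2c b₀ l into }) ⟩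
        Ex flows (λ l → ∏ V (λ v → noisy v l))              ≡⟨ factorise X noisy noisy-local V (allVertices-unique d) (edges-support V) ⟩
        ∏ V (λ v → Ex (flowsDist X (upEdges v)) (noisy v))  ≡⟨ ∏-cong V (λ v → trans (noisy-expectation v) (at-centers v)) ⟩
        ∏ V (λ v → if center v then r else 1ℚ)              ≡⟨ layer-product d h r ⟩
        powℚ r (d C h)                                      ∎))
      where
      open ≤-Reasoning
      V = allVertices d
      flows = flowsDist X (edges d)
      r = 1ℚ - powℚ ½ c
      b₀ = deviates X ξ₀
      support : Supported (FlowsOn X (edges d) IntoCenterZero) flows
      support = flows-support X (edges d) (edges-support V)
      at-centers : ∀ v → (if center v then 1ℚ - powℚ ½ (zeros v) else 1ℚ) ≡ (if center v then r else 1ℚ)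
      at-centers v with center v in cv
      ... | true  = cong (λ n → 1ℚ - powℚ ½ n) (zeros≡c v cv)
      ... | false = refl

open import Defs
open RationalArithmetic using (fromℕ; failure-bound)
open BinomialBounds using (middle-layer-large)
open Hypercube using (weight; zeros; zeros+weight)
open MiddleLayer using (module Construction)
open import Data.Nat.Combinatorics using (_C_)
open import Data.Nat using (ℕ; zero; suc; _≥_; _^_)
open import Data.Nat as ℕ using (⌊_/2⌋; ⌈_/2⌉)
open import Data.Nat.Properties using (+-comm; +-cancelʳ-≡; ⌊n/2⌋+⌈n/2⌉≡n; ⌊n/2⌋≤⌈n/2⌉; +-monoˡ-≤; ≤-trans; ≤-reflexive)
open import Data.Integer using (+_)
open import Data.Product using (Σ; _×_; _,_; proj₁; proj₂)
open import Data.Rational using (0ℚ; 1ℚ; ½; _-_; _*_; _≤_; _/_)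
open import Relation.Binary.PropositionalEquality

middle-zeros : ∀ {d} (v : Vertex d) → weight v ≡ ⌊ d /2⌋ → zeros v ≡ ⌈ d /2⌉
middle-zeros {d} v middle = +-cancelʳ-≡ ⌊ d /2⌋ (zeros v) ⌈ d /2⌉
  (trans (cong (λ w → zeros v ℕ.+ w) (sym middle)) (trans (zeros+weight v) (trans (sym (⌊n/2⌋+⌈n/2⌉≡n d)) (+-comm ⌊ d /2⌋ ⌈ d /2⌉))))

d≤2⌈d/2⌉ : ∀ d → d ℕ.≤ ⌈ d /2⌉ ℕ.+ ⌈ d /2⌉
d≤2⌈d/2⌉ d = ≤-trans (≤-reflexive (sym (⌊n/2⌋+⌈n/2⌉≡n d))) (+-monoˡ-≤ ⌈ d /2⌉ (⌊n/2⌋≤⌈n/2⌉ d))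

middle-layer-lower-bound : ∀ k → 18 ℕ.≤ suc k →
  let open Construction k ⌊ suc k /2⌋ in powℚ (1ℚ - probDeviationBy X 1) 8 * fromℕ (2 ^ suc k) ≤ 1ℚ
middle-layer-lower-bound k 18≤d = failure-bound (1ℚ - probDeviationBy X 1) ⌈ d /2⌉ (d C ⌊ d /2⌋) d 8
  (proj₁ no-deviation) (proj₂ no-deviation) (middle-layer-large d 18≤d)
  where
  open Construction k ⌊ suc k /2⌋
  no-deviation : 0ℚ ≤ 1ℚ - probDeviationBy X 1 × 1ℚ - probDeviationBy X 1 ≤ powℚ (1ℚ - powℚ ½ ⌈ d /2⌉) (d C ⌊ d /2⌋)
  no-deviation = failure-probability ⌈ d /2⌉ (λ v c → middle-zeros v (center⇒weight v c)) (d≤2⌈d/2⌉ d)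

mainTheorem3 : Σ ℕ λ k → Σ ℕ λ D → (d : ℕ) → d ≥ D →
    Σ (Vertex d → ℕ) λ x0 → Σ ℕ λ T →
      powℚ (1ℚ - probDeviationBy (λ v → + (x0 v)) T) (suc k) * ((+ (2 ^ d)) / 1) ≤ 1ℚ
mainTheorem3 = 7 , 18 , λ { zero () ; (suc k) 18≤d → Construction.initialLoad k ⌊ suc k /2⌋ , 1 , middle-layer-lower-bound k 18≤d }
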